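{- Let $\xi$ be a topological generator of $\Gamma_1$ with $\chi(\xi)\equiv1+zp\pmod{p^2}$, where $0<z\le p-1$, and let $\Sigma,s\in\mathbb{Z}$. If $v:=v_p\big(\Sigma+s\frac{p^f-1}{p-1}\big)<\infty$ and $\Sigma+s\frac{p^f-1}{p-1}=\sum_{j\ge v}s_jp^j$ (its $p$-adic expansion), then $$(\lambda_\xi^{\Sigma}\xi-1)(\pi^s)\in\overline{s_vz}\big(\pi^{s+(p-1)p^v}+\pi^{s+p^{v+1}}\big)+\pi^{s+2p^v(p-1)}\mathbb{F}_p[[\pi^{p^v}]].$$
   Context: $p>2$ is a prime, $K$ an unramified extension of $\mathbb{Q}_p$ of degree $f$, $\chi$ the cyclotomic character, $\bar\chi$ its reduction, $\Gamma=\mathrm{Gal}(K(\mu_{p^\infty})/K)$, $\Gamma_1=\mathrm{Gal}(K(\mu_{p^\infty})/K(\mu_p))$. $\Gamma$ acts on $\mathbb{F}_p((\pi))$ by $\gamma(\pi)=(1+\pi)^{\chi(\gamma)}-1$. For $\gamma\in\Gamma$, $\lambda_\gamma\in\mathbb{F}_p[[\pi]]$ is the unique $\frac{p^f-1}{p-1}$-th root of $\gamma(\pi)/(\bar\chi(\gamma)\pi)$ with $\lambda_\gamma\equiv1\bmod\pi$; $(\lambda_\gamma^\Sigma\gamma-1)(x):=\lambda_\gamma^\Sigma\gamma(x)-x$. The $s_j$ are the $p$-adic digits ($0\le s_j\le p-1$), and $\overline{s_vz}$ is the reduction of $s_vz$ mod $p$. -}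

module Defs where

open import Data.Nat as ℕ using (ℕ; zero; suc; _∸_; _^_; _<_; _≤_)
open import Data.Nat.Combinatorics using (_C_)
open import Data.Integer as ℤ using (ℤ; +_; _+_; _-_; _*_; -_)
open import Data.Integer.Divisibility using (_∣_)
open import Data.Product using (_×_)
open import Data.Sum using (_⊎_)
open import Relation.Nullary using (¬_; yes; no)
open import Data.Nat.Divisibility using () renaming (_∣_ to _∣ℕ_)

-- Formal power series in π with integer coefficients; they are viewed
-- in 𝔽_p[[π]] by reducing coefficients mod p (see _≈[_]_ below).
PS : Set
PS = ℕ → ℤ

infix 4 _≡[_]_ _≈[_]_
infixl 6 _⊕_ _⊖_
infixl 7 _⊛_
infixr 8 _^ₚ_

_≡[_]_ : ℤ → ℕ → ℤ → Set
x ≡[ p ] y = (+ p) ∣ (x - y)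

_≈[_]_ : PS → ℕ → PS → Set
f ≈[ p ] g = ∀ n → f n ≡[ p ] g n

one : PS
one zero    = + 1
one (suc _) = + 0

πpow : ℕ → PS
πpow k n with k ℕ.≟ n
... | yes _ = + 1
... | no  _ = + 0

_⊕_ : PS → PS → PS
(f ⊕ g) n = f n + g n

_⊖_ : PS → PS → PS
(f ⊖ g) n = f n - g n

scale : ℤ → PS → PS
scale c f n = c * f n

conv : PS → PS → ℕ → ℕ → ℤ
conv f g n zero    = f 0 * g n
conv f g n (suc i) = conv f g n i + f (suc i) * g (n ∸ suc i)

_⊛_ : PS → PS → PS
(f ⊛ g) n = conv f g n n

_^ₚ_ : PS → ℕ → PS
f ^ₚ zero  = one
f ^ₚ suc k = f ⊛ (f ^ₚ k)

-- "w is f^k in 𝔽_p[[π]]" for an integer exponent k (for k < 0 this means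
-- w is the inverse of f^{|k|}; only used for f with constant term 1).
IsPowℤ : ℕ → PS → ℤ → PS → Set
IsPowℤ p f (+ k)      w = w ≈[ p ] (f ^ₚ k)
IsPowℤ p f ℤ.-[1+ k ] w = (w ⊛ (f ^ₚ suc k)) ≈[ p ] one

-- p-adic integers as digit sequences a = Σ_j a_j p^j, 0 ≤ a_j < p
record ℤₚ (p : ℕ) : Set where
  field
    digit   : ℕ → ℕ
    digit<p : ∀ j → digit j < p
open ℤₚ public

truncℤₚ : {p : ℕ} → ℤₚ p → ℕ → ℕ
truncℤₚ a zero    = 0
truncℤₚ {p} a (suc m) = truncℤₚ a m ℕ.+ digit a m ℕ.* p ^ m

-- (1+π)^a ∈ 𝔽_p[[π]] for a ∈ ℤ_p, defined by continuity in a: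
-- its π^n coefficient is that of (1+π)^(a mod p^(n+1)), i.e. binom(a mod p^(n+1), n).
onePlusπPow : {p : ℕ} → ℤₚ p → PS
onePlusπPow a n = + (truncℤₚ a (suc n) C n)

-- γ(π) = (1+π)^{χ(γ)} - 1, where a = χ(γ)
γπ : {p : ℕ} → ℤₚ p → PS
γπ a = onePlusπPow a ⊖ one

-- γ(π)/π (γ(π) has zero constant term, so division by π is a shift)
γπ/π : {p : ℕ} → ℤₚ p → PS
γπ/π a n = γπ a (suc n)

-- (p^f - 1)/(p - 1) = 1 + p + ... + p^(f-1)
geomSum : ℕ → ℕ → ℕ
geomSum p zero    = 0
geomSum p (suc f) = geomSum p f ℕ.+ p ^ f

-- membership of h in  c(π^A + π^B) + π^C 𝔽_p[[π^q]]
InTarget : ℕ → PS → ℤ → ℕ → ℕ → ℕ → ℕ → Set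
InTarget p h c A B C q =
  ∀ n → (n < C ⊎ (C ≤ n × ¬ (q ∣ℕ (n ∸ C))))
      → h n ≡[ p ] (c * (πpow A n + πpow B n))

{-# OPTIONS --safe #-}
-- Put N = Σ + s(p^f - 1)/(p - 1) = m·p^v and q = p^v. As L·U = λ^Σ (γ(π)/π)^s and γ(π)/π = λ^((p^f-1)/(p-1)),
-- L·U = λ^N = (λ^m)^q, and in 𝔽_p[[π]] the Frobenius turns q-th powers into dilations, so L·U = Y(π^q)
-- with Y = λ^m. Because χ ≡ 1 + zp (mod p²), γ(π)/π ≡ 1 + z(π^(p-1) + π^p) modulo π^(2(p-1)); since
-- (p^f - 1)/(p - 1) ≡ 1 (mod p), its root λ has the same expansion, hence Y ≡ 1 + mz(π^(p-1) + π^p) with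
-- m ≡ s_v (mod p), and dilating gives the claim. No series is ever inverted: a power with exponent P - Q
-- is recorded as w·λ^Q = λ^P, and Y is read off from the coefficients of L·U at the multiples of q.
module Submission where

open import Defs

open import Data.Empty using (⊥-elim)
open import Data.Fin as Fin using (Fin; fromℕ; inject₁)
import Data.Fin.Properties as FinP
open import Data.Integer as ℤ using (ℤ; +_; -[1+_]; _+_; _-_; _*_; -_)
open import Data.Integer.Divisibility using (_∣_)
import Data.Integer.Divisibility.Signed as ℤ∣
import Data.Integer.Properties as ℤP
open import Data.Integer.Tactic.RingSolver using (solve-∀)
open import Data.Nat as ℕ using (ℕ; zero; suc; _<_; _≤_; _∸_; _^_; z≤n; s≤s; NonZero)
open import Data.Nat.Combinatorics
  using (_C_; nCn≡1; k![n∸k]!∣n!; nCk≡n!/k![n-k]!; k>n⇒nCk≡0; nCk+nC[k+1]≡[n+1]C[k+1])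
open import Data.Nat.Divisibility as ℕ∣ using (divides; _∣?_) renaming (_∣_ to _∣ℕ_)
open import Data.Nat.DivMod using (m/n*n≡m)
open import Data.Nat.Induction using (<-rec)
open import Data.Nat.Primality using (Prime; euclidsLemma; prime⇒nonZero; ¬prime[1])
import Data.Nat.Properties as ℕP
open import Data.Nat.Tactic.RingSolver using () renaming (solve-∀ to ℕ-solve-∀)
open import Data.Product using (∃; _×_; _,_; proj₁; proj₂)
open import Data.Sum using (_⊎_; inj₁; inj₂)
open import Data.Unit using (⊤; tt)
open import Function using (_∘_)
open import Level using (0ℓ)
open import Relation.Binary.Bundles using (Setoid)
open import Relation.Binary.Definitions using (tri<; tri≈; tri>)
open import Relation.Binary.PropositionalEquality
  using (_≡_; _≢_; _≗_; refl; sym; trans; cong; cong₂; subst; module ≡-Reasoning)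
import Relation.Binary.Reasoning.Setoid as SetoidReasoning
open import Relation.Binary.Structures using (IsEquivalence)
open import Relation.Nullary using (¬_; yes; no)
open import Algebra.Bundles using (CommutativeSemiring)
import Algebra.Properties.CommutativeSemiring.Binomial as Binomial
import Algebra.Properties.Semiring.Exp as SemiringExp
import Algebra.Properties.Semiring.Mult as SemiringMult
import Algebra.Properties.Semiring.Sum as SemiringSum
open import Algebra.Structures using (IsCommutativeMonoid)
import Algebra.Structures.Biased as Biased

-- Integers modulo m

module Congruence (m : ℕ) where

  infix 4 _≋_
  record _≋_ (x y : ℤ) : Set where
    constructor mk≋
    field divides-difference : + m ℤ∣.∣ x - y
  open _≋_ public

  private
    by-difference : ∀ {x y} d → x - y ≡ d → + m ℤ∣.∣ d → x ≋ y
    by-difference d eq m∣d = mk≋ (subst (+ m ℤ∣.∣_) (sym eq) m∣d)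

  ≋-refl : ∀ {x} → x ≋ x
  ≋-refl {x} = by-difference (+ 0 * x) (lemma x) (ℤ∣.divides (+ 0) refl)
    where lemma : ∀ x → x - x ≡ + 0 * x
          lemma = solve-∀

  ≡⇒≋ : ∀ {x y} → x ≡ y → x ≋ y
  ≡⇒≋ refl = ≋-refl

  ≋-sym : ∀ {x y} → x ≋ y → y ≋ x
  ≋-sym {x} {y} (mk≋ d) = by-difference _ (lemma x y) (ℤ∣.∣m⇒∣-m d)
    where lemma : ∀ x y → y - x ≡ - (x - y)
          lemma = solve-∀

  ≋-trans : ∀ {x y z} → x ≋ y → y ≋ z → x ≋ z
  ≋-trans {x} {y} {z} (mk≋ d) (mk≋ e) = by-difference _ (lemma x y z) (ℤ∣.∣m∣n⇒∣m+n d e)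
    where lemma : ∀ x y z → x - z ≡ (x - y) + (y - z)
          lemma = solve-∀

  ≋-isEquivalence : IsEquivalence _≋_
  ≋-isEquivalence = record { refl = ≋-refl ; sym = ≋-sym ; trans = ≋-trans }

  ≋-setoid : Setoid 0ℓ 0ℓ
  ≋-setoid = record { isEquivalence = ≋-isEquivalence }

  module ≋-Reasoning = SetoidReasoning ≋-setoid

  +-cong : ∀ {x y u w} → x ≋ y → u ≋ w → x + u ≋ y + w
  +-cong {x} {y} {u} {w} (mk≋ d) (mk≋ e) = by-difference _ (lemma x y u w) (ℤ∣.∣m∣n⇒∣m+n d e)
    where lemma : ∀ x y u w → (x + u) - (y + w) ≡ (x - y) + (u - w)
          lemma = solve-∀

  *-cong : ∀ {x y u w} → x ≋ y → u ≋ w → x * u ≋ y * w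
  *-cong {x} {y} {u} {w} (mk≋ d) (mk≋ e) =
    by-difference _ (lemma x y u w) (ℤ∣.∣m∣n⇒∣m+n (ℤ∣.∣m⇒∣m*n u d) (ℤ∣.∣n⇒∣m*n y e))
    where lemma : ∀ x y u w → x * u - y * w ≡ (x - y) * u + y * (u - w)
          lemma = solve-∀

  -‿cong : ∀ {x y} → x ≋ y → - x ≋ - y
  -‿cong {x} {y} (mk≋ d) = by-difference _ (lemma x y) (ℤ∣.∣m⇒∣-m d)
    where lemma : ∀ x y → (- x) - (- y) ≡ - (x - y)
          lemma = solve-∀

  multiple≋0 : ∀ k → k * + m ≋ + 0
  multiple≋0 k = by-difference (k * + m) (ℤP.+-identityʳ (k * + m)) (ℤ∣.divides k refl)

  fromCongruent : ∀ {x y} → x ≡[ m ] y → x ≋ y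
  fromCongruent d = mk≋ (ℤ∣.∣ᵤ⇒∣ d)

  toCongruent : ∀ {x y} → x ≋ y → x ≡[ m ] y
  toCongruent (mk≋ d) = ℤ∣.∣⇒∣ᵤ d

  ^-cong : ∀ k {x y} → x ≋ y → x ℤ.^ k ≋ y ℤ.^ k
  ^-cong zero    _   = ≋-refl
  ^-cong (suc k) x≋y = *-cong x≋y (^-cong k x≋y)

  difference≋0⇒≋ : ∀ {x y} → x - y ≋ + 0 → x ≋ y
  difference≋0⇒≋ {x} {y} (mk≋ d) = mk≋ (subst (+ m ℤ∣.∣_) (ℤP.+-identityʳ (x - y)) d)

  quotient≋ : ∀ {q N} .{{_ : NonZero q}} s (q∣N : + q ℤ∣.∣ N) → + (m ℕ.* q) ℤ∣.∣ N - + (s ℕ.* q)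
    → ℤ∣._∣_.quotient q∣N ≋ + s
  quotient≋ {q} {N} s (ℤ∣.divides k N≡k*q) (ℤ∣.divides j N-s*q≡j*m*q) =
    by-difference (j * + m) (ℤP.*-cancelʳ-≡ (k - + s) (j * + m) (+ q) (begin
      (k - + s) * + q         ≡⟨ lemma k (+ s) (+ q) ⟩
      k * + q - + s * + q     ≡⟨ cong₂ _-_ N≡k*q (ℤP.pos-* s q) ⟨
      N - + (s ℕ.* q)         ≡⟨ N-s*q≡j*m*q ⟩
      j * + (m ℕ.* q)         ≡⟨ cong (j *_) (ℤP.pos-* m q) ⟩
      j * (+ m * + q)         ≡⟨ ℤP.*-assoc j (+ m) (+ q) ⟨
      j * + m * + q           ∎)) (ℤ∣.divides j refl)
    where
    open ≡-Reasoning
    lemma : ∀ k s q → (k - s) * q ≡ k * q - s * q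
    lemma = solve-∀

  geomSum≋1 : ∀ f → 1 ≤ f → + geomSum m f ≋ + 1
  geomSum≋1 (suc zero)    _ = ≋-refl
  geomSum≋1 (suc (suc f)) _ = begin
    + (geomSum m (suc f) ℕ.+ m ℕ.* m ^ f)      ≡⟨ ℤP.pos-+ (geomSum m (suc f)) (m ℕ.* m ^ f) ⟩
    + geomSum m (suc f) + + (m ℕ.* m ^ f)      ≡⟨ cong (_+_ (+ geomSum m (suc f))) (trans (ℤP.pos-* m (m ^ f)) (ℤP.*-comm (+ m) (+ (m ^ f)))) ⟩
    + geomSum m (suc f) + + (m ^ f) * + m      ≈⟨ +-cong (geomSum≋1 (suc f) (s≤s z≤n)) (multiple≋0 (+ (m ^ f))) ⟩
    + 1                                        ∎
    where open ≋-Reasoning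

  ≋0⇒*ʳ≋0 : ∀ {x} y → x ≋ + 0 → x * y ≋ + 0
  ≋0⇒*ʳ≋0 {x} y x≋0 = ≋-trans (*-cong x≋0 (≋-refl {y})) (≡⇒≋ (ℤP.*-zeroˡ y))

  ≋0⇒*ˡ≋0 : ∀ x {y} → y ≋ + 0 → x * y ≋ + 0
  ≋0⇒*ˡ≋0 x y≋0 = ≋-trans (*-cong (≋-refl {x}) y≋0) (≡⇒≋ (ℤP.*-zeroʳ x))

-- Exact identities of integer power series

tail : PS → PS
tail f n = f (suc n)

shift : PS → PS
shift f zero    = + 0
shift f (suc n) = f n

shiftBy : ℕ → PS → PS
shiftBy zero    f = f
shiftBy (suc k) f = shift (shiftBy k f)

constant : ℤ → PS
constant c zero    = c
constant c (suc _) = + 0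

zeroₚ : PS
zeroₚ _ = + 0

conv-suc : ∀ f g n i → conv f g (suc n) (suc i) ≡ f 0 * g (suc n) + conv (tail f) g n i
conv-suc f g n zero    = refl
conv-suc f g n (suc i) = begin
  conv f g (suc n) (suc i) + f (suc (suc i)) * g (n ∸ suc i)
    ≡⟨ cong (_+ f (suc (suc i)) * g (n ∸ suc i)) (conv-suc f g n i) ⟩
  f 0 * g (suc n) + conv (tail f) g n i + f (suc (suc i)) * g (n ∸ suc i)
    ≡⟨ ℤP.+-assoc (f 0 * g (suc n)) _ _ ⟩
  f 0 * g (suc n) + conv (tail f) g n (suc i) ∎
  where open ≡-Reasoning

⊛-suc : ∀ f g n → (f ⊛ g) (suc n) ≡ f 0 * g (suc n) + (tail f ⊛ g) n
⊛-suc f g n = conv-suc f g n n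

⊛-sucʳ : ∀ f g n → (f ⊛ g) (suc n) ≡ (f ⊛ tail g) n + f (suc n) * g 0
⊛-sucʳ f g zero    = refl
⊛-sucʳ f g (suc n) = begin
  (f ⊛ g) (suc (suc n))                                      ≡⟨ ⊛-suc f g (suc n) ⟩
  f 0 * g (suc (suc n)) + (tail f ⊛ g) (suc n)               ≡⟨ cong (_+_ (f 0 * g (suc (suc n)))) (⊛-sucʳ (tail f) g n) ⟩
  f 0 * g (suc (suc n)) + ((tail f ⊛ tail g) n + f (suc (suc n)) * g 0)
    ≡⟨ ℤP.+-assoc (f 0 * g (suc (suc n))) _ _ ⟨
  f 0 * g (suc (suc n)) + (tail f ⊛ tail g) n + f (suc (suc n)) * g 0
    ≡⟨ cong (_+ f (suc (suc n)) * g 0) (⊛-suc f (tail g) n) ⟨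
  (f ⊛ tail g) (suc n) + f (suc (suc n)) * g 0 ∎
  where open ≡-Reasoning

conv-cong : ∀ {f f′ g g′} → f ≗ f′ → g ≗ g′ → ∀ n i → conv f g n i ≡ conv f′ g′ n i
conv-cong f≗ g≗ n zero    = cong₂ _*_ (f≗ 0) (g≗ n)
conv-cong f≗ g≗ n (suc i) = cong₂ _+_ (conv-cong f≗ g≗ n i) (cong₂ _*_ (f≗ (suc i)) (g≗ (n ∸ suc i)))

⊛-cong : ∀ {f f′ g g′} → f ≗ f′ → g ≗ g′ → f ⊛ g ≗ f′ ⊛ g′
⊛-cong f≗ g≗ n = conv-cong f≗ g≗ n n

⊛-congˡ : ∀ f {g g′} → g ≗ g′ → f ⊛ g ≗ f ⊛ g′
⊛-congˡ f = ⊛-cong (λ _ → refl)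

⊛-zeroˡ : ∀ g → zeroₚ ⊛ g ≗ zeroₚ
⊛-zeroˡ g n = conv-zeroˡ n
  where conv-zeroˡ : ∀ i → conv zeroₚ g n i ≡ + 0
        conv-zeroˡ zero    = ℤP.*-zeroˡ (g n)
        conv-zeroˡ (suc i) = cong₂ _+_ (conv-zeroˡ i) (ℤP.*-zeroˡ (g (n ∸ suc i)))

⊛-identityˡ : ∀ g → one ⊛ g ≗ g
⊛-identityˡ g zero    = ℤP.*-identityˡ (g 0)
⊛-identityˡ g (suc n) =
  trans (⊛-suc one g n) (trans (cong₂ _+_ (ℤP.*-identityˡ (g (suc n))) (⊛-zeroˡ g n)) (ℤP.+-identityʳ _))

⊛-comm : ∀ f g → f ⊛ g ≗ g ⊛ f
⊛-comm f g zero    = ℤP.*-comm (f 0) (g 0)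
⊛-comm f g (suc n) = begin
  (f ⊛ g) (suc n)                ≡⟨ ⊛-suc f g n ⟩
  f 0 * g (suc n) + (tail f ⊛ g) n ≡⟨ cong₂ _+_ (ℤP.*-comm (f 0) (g (suc n))) (⊛-comm (tail f) g n) ⟩
  g (suc n) * f 0 + (g ⊛ tail f) n ≡⟨ ℤP.+-comm (g (suc n) * f 0) _ ⟩
  (g ⊛ tail f) n + g (suc n) * f 0 ≡⟨ ⊛-sucʳ g f n ⟨
  (g ⊛ f) (suc n)                ∎
  where open ≡-Reasoning

⊛-identityʳ : ∀ g → g ⊛ one ≗ g
⊛-identityʳ g n = trans (⊛-comm g one n) (⊛-identityˡ g n)

⊛-distribʳ-⊕ : ∀ f f′ g → (f ⊕ f′) ⊛ g ≗ (f ⊛ g) ⊕ (f′ ⊛ g)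
⊛-distribʳ-⊕ f f′ g n = conv-distribʳ n
  where
  lemma : ∀ a b c d e → a + b + (c + d) * e ≡ (a + c * e) + (b + d * e)
  lemma = solve-∀
  conv-distribʳ : ∀ i → conv (f ⊕ f′) g n i ≡ conv f g n i + conv f′ g n i
  conv-distribʳ zero    = ℤP.*-distribʳ-+ (g n) (f 0) (f′ 0)
  conv-distribʳ (suc i) = trans (cong (_+ (f (suc i) + f′ (suc i)) * g (n ∸ suc i)) (conv-distribʳ i))
                     (lemma (conv f g n i) (conv f′ g n i) (f (suc i)) (f′ (suc i)) (g (n ∸ suc i)))

⊛-distribˡ-⊕ : ∀ f g g′ → f ⊛ (g ⊕ g′) ≗ (f ⊛ g) ⊕ (f ⊛ g′)
⊛-distribˡ-⊕ f g g′ n = trans (⊛-comm f (g ⊕ g′) n)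
  (trans (⊛-distribʳ-⊕ g g′ f n) (cong₂ _+_ (⊛-comm g f n) (⊛-comm g′ f n)))

scale-⊛ : ∀ c f g → scale c f ⊛ g ≗ scale c (f ⊛ g)
scale-⊛ c f g n = conv-scale n
  where
  conv-scale : ∀ i → conv (scale c f) g n i ≡ c * conv f g n i
  conv-scale zero    = ℤP.*-assoc c (f 0) (g n)
  conv-scale (suc i) = trans (cong₂ _+_ (conv-scale i) (ℤP.*-assoc c (f (suc i)) (g (n ∸ suc i))))
                     (sym (ℤP.*-distribˡ-+ c (conv f g n i) _))

⊛-scale : ∀ c f g → f ⊛ scale c g ≗ scale c (f ⊛ g)
⊛-scale c f g n = trans (⊛-comm f (scale c g) n) (trans (scale-⊛ c g f n) (cong (c *_) (⊛-comm g f n)))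

⊛-distribʳ-⊖ : ∀ f f′ g → (f ⊖ f′) ⊛ g ≗ (f ⊛ g) ⊖ (f′ ⊛ g)
⊛-distribʳ-⊖ f f′ g n = begin
  ((f ⊖ f′) ⊛ g) n                    ≡⟨ ⊛-cong (λ i → lemma (f i) (f′ i)) (λ _ → refl) n ⟩
  ((f ⊕ scale (- + 1) f′) ⊛ g) n      ≡⟨ ⊛-distribʳ-⊕ f (scale (- + 1) f′) g n ⟩
  (f ⊛ g) n + (scale (- + 1) f′ ⊛ g) n ≡⟨ cong (_+_ ((f ⊛ g) n)) (scale-⊛ (- + 1) f′ g n) ⟩
  (f ⊛ g) n + - + 1 * (f′ ⊛ g) n      ≡⟨ lemma ((f ⊛ g) n) ((f′ ⊛ g) n) ⟨
  ((f ⊛ g) ⊖ (f′ ⊛ g)) n              ∎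
  where
  open ≡-Reasoning
  lemma : ∀ x y → x - y ≡ x + - + 1 * y
  lemma = solve-∀

⊛-distribˡ-⊖ : ∀ f g g′ → f ⊛ (g ⊖ g′) ≗ (f ⊛ g) ⊖ (f ⊛ g′)
⊛-distribˡ-⊖ f g g′ n = trans (⊛-comm f (g ⊖ g′) n)
  (trans (⊛-distribʳ-⊖ g g′ f n) (cong₂ _-_ (⊛-comm g f n) (⊛-comm g′ f n)))

⊛-difference : ∀ a b c d → (a ⊛ b) ⊖ (c ⊛ d) ≗ (a ⊛ (b ⊖ d)) ⊕ ((a ⊖ c) ⊛ d)
⊛-difference a b c d n = begin
  (a ⊛ b) n - (c ⊛ d) n                                      ≡⟨ lemma ((a ⊛ b) n) ((a ⊛ d) n) ((c ⊛ d) n) ⟩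
  ((a ⊛ b) n - (a ⊛ d) n) + ((a ⊛ d) n - (c ⊛ d) n)          ≡⟨ cong₂ _+_ (⊛-distribˡ-⊖ a b d n) (⊛-distribʳ-⊖ a c d n) ⟨
  (a ⊛ (b ⊖ d)) n + ((a ⊖ c) ⊛ d) n                          ∎
  where
  open ≡-Reasoning
  lemma : ∀ x y z → x - z ≡ (x - y) + (y - z)
  lemma = solve-∀

⊛-assoc : ∀ f g h → (f ⊛ g) ⊛ h ≗ f ⊛ (g ⊛ h)
⊛-assoc f g h zero    = ℤP.*-assoc (f 0) (g 0) (h 0)
⊛-assoc f g h (suc n) = begin
  ((f ⊛ g) ⊛ h) (suc n)
    ≡⟨ ⊛-suc (f ⊛ g) h n ⟩
  f 0 * g 0 * h (suc n) + (tail (f ⊛ g) ⊛ h) n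
    ≡⟨ cong (_+_ (f 0 * g 0 * h (suc n))) (⊛-cong (⊛-suc f g) (λ _ → refl) n) ⟩
  f 0 * g 0 * h (suc n) + ((scale (f 0) (tail g) ⊕ (tail f ⊛ g)) ⊛ h) n
    ≡⟨ cong (_+_ (f 0 * g 0 * h (suc n))) (⊛-distribʳ-⊕ (scale (f 0) (tail g)) (tail f ⊛ g) h n) ⟩
  f 0 * g 0 * h (suc n) + ((scale (f 0) (tail g) ⊛ h) n + ((tail f ⊛ g) ⊛ h) n)
    ≡⟨ cong (_+_ (f 0 * g 0 * h (suc n))) (cong₂ _+_ (scale-⊛ (f 0) (tail g) h n) (⊛-assoc (tail f) g h n)) ⟩
  f 0 * g 0 * h (suc n) + (f 0 * (tail g ⊛ h) n + (tail f ⊛ (g ⊛ h)) n)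
    ≡⟨ lemma (f 0) (g 0) (h (suc n)) _ _ ⟩
  f 0 * (g 0 * h (suc n) + (tail g ⊛ h) n) + (tail f ⊛ (g ⊛ h)) n
    ≡⟨ cong (λ w → f 0 * w + (tail f ⊛ (g ⊛ h)) n) (⊛-suc g h n) ⟨
  f 0 * (g ⊛ h) (suc n) + (tail f ⊛ (g ⊛ h)) n
    ≡⟨ ⊛-suc f (g ⊛ h) n ⟨
  (f ⊛ (g ⊛ h)) (suc n) ∎
  where
  open ≡-Reasoning
  lemma : ∀ a b c x y → a * b * c + (a * x + y) ≡ a * (b * c + x) + y
  lemma = solve-∀

shift-cong : ∀ {f g} → f ≗ g → shift f ≗ shift g
shift-cong f≗g zero    = refl
shift-cong f≗g (suc n) = f≗g n

shiftBy-cong : ∀ k {f g} → f ≗ g → shiftBy k f ≗ shiftBy k g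
shiftBy-cong zero    f≗g = f≗g
shiftBy-cong (suc k) f≗g = shift-cong (shiftBy-cong k f≗g)

shift-⊛ : ∀ f g → shift f ⊛ g ≗ shift (f ⊛ g)
shift-⊛ f g zero    = ℤP.*-zeroˡ (g 0)
shift-⊛ f g (suc n) =
  trans (⊛-suc (shift f) g n) (trans (cong (_+ (f ⊛ g) n) (ℤP.*-zeroˡ (g (suc n)))) (ℤP.+-identityˡ _))

shiftBy-⊛ : ∀ k f g → shiftBy k f ⊛ g ≗ shiftBy k (f ⊛ g)
shiftBy-⊛ zero    f g n = refl
shiftBy-⊛ (suc k) f g n = trans (shift-⊛ (shiftBy k f) g n) (shift-cong (shiftBy-⊛ k f g) n)

⊛-shiftBy : ∀ k f g → f ⊛ shiftBy k g ≗ shiftBy k (f ⊛ g)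
⊛-shiftBy k f g n =
  trans (⊛-comm f (shiftBy k g) n) (trans (shiftBy-⊛ k g f n) (shiftBy-cong k (⊛-comm g f) n))

shiftBy-below : ∀ k f n → n < k → shiftBy k f n ≡ + 0
shiftBy-below (suc k) f zero    _         = refl
shiftBy-below (suc k) f (suc n) (s≤s n<k) = shiftBy-below k f n n<k

shiftBy-+ : ∀ k f n → shiftBy k f (k ℕ.+ n) ≡ f n
shiftBy-+ zero    f n = refl
shiftBy-+ (suc k) f n = shiftBy-+ k f n

constant-⊛ : ∀ c g → constant c ⊛ g ≗ scale c g
constant-⊛ c g zero    = refl
constant-⊛ c g (suc n) =
  trans (⊛-suc (constant c) g n) (trans (cong (_+_ (c * g (suc n))) (⊛-zeroˡ g n)) (ℤP.+-identityʳ _))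

constant+shift-tail : ∀ f → f ≗ constant (f 0) ⊕ shift (tail f)
constant+shift-tail f zero    = sym (ℤP.+-identityʳ (f 0))
constant+shift-tail f (suc n) = sym (ℤP.+-identityˡ (f (suc n)))

^ₚ-coeff₀ : ∀ f k → (f ^ₚ k) 0 ≡ f 0 ℤ.^ k
^ₚ-coeff₀ f zero    = refl
^ₚ-coeff₀ f (suc k) = cong (f 0 *_) (^ₚ-coeff₀ f k)

constant-^ₚ : ∀ c k → constant c ^ₚ k ≗ constant (c ℤ.^ k)
constant-^ₚ c zero    zero    = refl
constant-^ₚ c zero    (suc n) = refl
constant-^ₚ c (suc k) n =
  trans (⊛-congˡ (constant c) (constant-^ₚ c k) n) (trans (constant-⊛ c (constant (c ℤ.^ k)) n) (lemma n))
  where lemma : ∀ n → c * constant (c ℤ.^ k) n ≡ constant (c ℤ.^ suc k) n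
        lemma zero    = refl
        lemma (suc n) = ℤP.*-zeroʳ c

shift-^ₚ : ∀ f k → shift f ^ₚ k ≗ shiftBy k (f ^ₚ k)
shift-^ₚ f zero    n = refl
shift-^ₚ f (suc k) n =
  trans (⊛-congˡ (shift f) (shift-^ₚ f k) n)
        (trans (shift-⊛ f (shiftBy k (f ^ₚ k)) n) (shift-cong (⊛-shiftBy k f (f ^ₚ k)) n))

⊛-interchange : ∀ a b c d → (a ⊛ b) ⊛ (c ⊛ d) ≗ (a ⊛ c) ⊛ (b ⊛ d)
⊛-interchange a b c d n = begin
  ((a ⊛ b) ⊛ (c ⊛ d)) n ≡⟨ ⊛-assoc a b (c ⊛ d) n ⟩
  (a ⊛ (b ⊛ (c ⊛ d))) n ≡⟨ ⊛-congˡ a (λ i → sym (⊛-assoc b c d i)) n ⟩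
  (a ⊛ ((b ⊛ c) ⊛ d)) n ≡⟨ ⊛-congˡ a (⊛-cong (⊛-comm b c) (λ _ → refl)) n ⟩
  (a ⊛ ((c ⊛ b) ⊛ d)) n ≡⟨ ⊛-congˡ a (⊛-assoc c b d) n ⟩
  (a ⊛ (c ⊛ (b ⊛ d))) n ≡⟨ ⊛-assoc a c (b ⊛ d) n ⟨
  ((a ⊛ c) ⊛ (b ⊛ d)) n ∎
  where open ≡-Reasoning

^ₚ-+ : ∀ f m n → f ^ₚ (m ℕ.+ n) ≗ (f ^ₚ m) ⊛ (f ^ₚ n)
^ₚ-+ f zero    n i = sym (⊛-identityˡ (f ^ₚ n) i)
^ₚ-+ f (suc m) n i = trans (⊛-congˡ f (^ₚ-+ f m n) i) (sym (⊛-assoc f (f ^ₚ m) (f ^ₚ n) i))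

^ₚ-* : ∀ f m n → f ^ₚ (m ℕ.* n) ≗ (f ^ₚ m) ^ₚ n
^ₚ-* f m zero    rewrite ℕP.*-zeroʳ m   = λ _ → refl
^ₚ-* f m (suc n) rewrite ℕP.*-suc m n =
  λ i → trans (^ₚ-+ f m (m ℕ.* n) i) (⊛-congˡ (f ^ₚ m) (^ₚ-* f m n) i)

^ₚ-distrib-⊛ : ∀ f g n → (f ⊛ g) ^ₚ n ≗ (f ^ₚ n) ⊛ (g ^ₚ n)
^ₚ-distrib-⊛ f g zero    i = sym (⊛-identityˡ one i)
^ₚ-distrib-⊛ f g (suc n) i =
  trans (⊛-congˡ (f ⊛ g) (^ₚ-distrib-⊛ f g n) i) (⊛-interchange f g (f ^ₚ n) (g ^ₚ n) i)

one-^ₚ : ∀ n → one ^ₚ n ≗ one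
one-^ₚ zero    i = refl
one-^ₚ (suc n) i = trans (⊛-identityˡ (one ^ₚ n) i) (one-^ₚ n i)

πpow-diagonal : ∀ k → πpow k k ≡ + 1
πpow-diagonal k with k ℕ.≟ k
... | yes _   = refl
... | no k≢k  = ⊥-elim (k≢k refl)

πpow-off-diagonal : ∀ {k n} → k ≢ n → πpow k n ≡ + 0
πpow-off-diagonal {k} {n} k≢n with k ℕ.≟ n
... | yes k≡n = ⊥-elim (k≢n k≡n)
... | no _    = refl

πpow-below : ∀ k n → n < k → πpow k n ≡ + 0
πpow-below k n n<k = πpow-off-diagonal (λ k≡n → ℕP.<-irrefl (sym k≡n) n<k)

shiftBy-one : ∀ k → shiftBy k one ≗ πpow k
shiftBy-one k n with ℕP.<-cmp n k
... | tri< n<k _ _ = trans (shiftBy-below k one n n<k) (sym (πpow-below k n n<k))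
... | tri≈ _ refl _ = trans (cong (shiftBy k one) (sym (ℕP.+-identityʳ k)))
                            (trans (shiftBy-+ k one 0) (sym (πpow-diagonal k)))
... | tri> _ _ k<n = trans (cong (shiftBy k one) (sym (ℕP.m+[n∸m]≡n (ℕP.<⇒≤ k<n))))
                           (trans (shiftBy-+ k one (n ∸ k)) (lemma (ℕP.m>n⇒m∸n≢0 k<n)))
  where lemma : ∀ {d} → d ≢ 0 → one d ≡ πpow k n
        lemma {zero}  d≢0 = ⊥-elim (d≢0 refl)
        lemma {suc d} _   = sym (πpow-off-diagonal (ℕP.<⇒≢ k<n))

πpow-suc : ∀ k n → πpow (suc k) (suc n) ≡ πpow k n
πpow-suc k n with k ℕ.≟ n
... | yes refl = πpow-diagonal (suc k)
... | no k≢n   = πpow-off-diagonal (λ k+1≡n+1 → k≢n (ℕP.suc-injective k+1≡n+1))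

-- Congruence of power series modulo p on a downward closed set of indices

module SeriesCongruence (p : ℕ) (B : ℕ → Set) (B-down : ∀ {i n} → i ≤ n → B n → B i) where
  open Congruence p

  infix 4 _≈_
  record _≈_ (f g : PS) : Set where
    constructor mk≈
    field at : ∀ n → B n → f n ≋ g n
  open _≈_ public

  ≗⇒≈ : ∀ {f g} → f ≗ g → f ≈ g
  ≗⇒≈ f≗g = mk≈ λ n _ → ≡⇒≋ (f≗g n)

  ≈-refl : ∀ {f} → f ≈ f
  ≈-refl = mk≈ λ _ _ → ≋-refl

  ≈-sym : ∀ {f g} → f ≈ g → g ≈ f
  ≈-sym f≈g = mk≈ λ n b → ≋-sym (at f≈g n b)

  ≈-trans : ∀ {f g h} → f ≈ g → g ≈ h → f ≈ h
  ≈-trans f≈g g≈h = mk≈ λ n b → ≋-trans (at f≈g n b) (at g≈h n b)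

  ≈-isEquivalence : IsEquivalence _≈_
  ≈-isEquivalence = record { refl = ≈-refl ; sym = ≈-sym ; trans = ≈-trans }

  ≈-setoid : Setoid 0ℓ 0ℓ
  ≈-setoid = record { isEquivalence = ≈-isEquivalence }

  module ≈-Reasoning = SetoidReasoning ≈-setoid

  ⊕-cong : ∀ {f f′ g g′} → f ≈ f′ → g ≈ g′ → f ⊕ g ≈ f′ ⊕ g′
  ⊕-cong f≈ g≈ = mk≈ λ n b → +-cong (at f≈ n b) (at g≈ n b)

  ⊖-cong : ∀ {f f′ g g′} → f ≈ f′ → g ≈ g′ → f ⊖ g ≈ f′ ⊖ g′
  ⊖-cong f≈ g≈ = mk≈ λ n b → +-cong (at f≈ n b) (-‿cong (at g≈ n b))

  scale-cong : ∀ {c c′ f f′} → c ≋ c′ → f ≈ f′ → scale c f ≈ scale c′ f′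
  scale-cong c≋ f≈ = mk≈ λ n b → *-cong c≋ (at f≈ n b)

  ⊛-cong≈ : ∀ {f f′ g g′} → f ≈ f′ → g ≈ g′ → f ⊛ g ≈ f′ ⊛ g′
  ⊛-cong≈ {f} {f′} {g} {g′} f≈ g≈ = mk≈ λ n b → conv-cong≈ n b n ℕP.≤-refl
    where
    conv-cong≈ : ∀ n → B n → ∀ i → i ≤ n → conv f g n i ≋ conv f′ g′ n i
    conv-cong≈ n b zero    _   = *-cong (at f≈ 0 (B-down z≤n b)) (at g≈ n b)
    conv-cong≈ n b (suc i) i<n = +-cong (conv-cong≈ n b i (ℕP.<⇒≤ i<n))
      (*-cong (at f≈ (suc i) (B-down i<n b)) (at g≈ (n ∸ suc i) (B-down (ℕP.m∸n≤m n (suc i)) b)))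

  ⊛-congˡ≈ : ∀ h {f g} → f ≈ g → h ⊛ f ≈ h ⊛ g
  ⊛-congˡ≈ h = ⊛-cong≈ ≈-refl

  ⊛-congʳ≈ : ∀ h {f g} → f ≈ g → f ⊛ h ≈ g ⊛ h
  ⊛-congʳ≈ h f≈g = ⊛-cong≈ f≈g ≈-refl

  seriesSemiring : CommutativeSemiring 0ℓ 0ℓ
  seriesSemiring = record
    { Carrier = PS ; _≈_ = _≈_ ; _+_ = _⊕_ ; _*_ = _⊛_ ; 0# = zeroₚ ; 1# = one
    ; isCommutativeSemiring = Biased.IsCommutativeSemiringˡ.isCommutativeSemiring record
      { +-isCommutativeMonoid = commutativeMonoid _⊕_ zeroₚ ⊕-cong
          (λ f g h n → ℤP.+-assoc (f n) (g n) (h n)) (λ f n → ℤP.+-identityˡ (f n)) (λ f g n → ℤP.+-comm (f n) (g n))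
      ; *-isCommutativeMonoid = commutativeMonoid _⊛_ one ⊛-cong≈ ⊛-assoc ⊛-identityˡ ⊛-comm
      ; distribʳ = λ h f g → ≗⇒≈ (⊛-distribʳ-⊕ f g h)
      ; zeroˡ    = λ f → ≗⇒≈ (⊛-zeroˡ f)
      } }
    where
    commutativeMonoid : ∀ _∙_ ε → (∀ {f f′ g g′} → f ≈ f′ → g ≈ g′ → (f ∙ g) ≈ (f′ ∙ g′))
      → (∀ f g h → (f ∙ g) ∙ h ≗ f ∙ (g ∙ h)) → (∀ f → ε ∙ f ≗ f) → (∀ f g → f ∙ g ≗ g ∙ f)
      → IsCommutativeMonoid _≈_ _∙_ ε
    commutativeMonoid _∙_ ε ∙-cong assoc identityˡ comm = Biased.IsCommutativeMonoidˡ.isCommutativeMonoid record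
      { isSemigroup = record
        { isMagma = record { isEquivalence = ≈-isEquivalence ; ∙-cong = ∙-cong }
        ; assoc = λ f g h → ≗⇒≈ (assoc f g h) }
      ; identityˡ = λ f → ≗⇒≈ (identityˡ f)
      ; comm = λ f g → ≗⇒≈ (comm f g) }

  ^ₚ-cong≈ : ∀ {f g} k → f ≈ g → f ^ₚ k ≈ g ^ₚ k
  ^ₚ-cong≈ zero    f≈g = ≈-refl
  ^ₚ-cong≈ (suc k) f≈g = ⊛-cong≈ f≈g (^ₚ-cong≈ k f≈g)

Everywhere : ℕ → Set
Everywhere _ = ⊤

Everywhere-down : ∀ {i n} → i ≤ n → Everywhere n → Everywhere i
Everywhere-down _ _ = tt

module Full (p : ℕ) = SeriesCongruence p Everywhere Everywhere-down

module Below (p K : ℕ) = SeriesCongruence p (_< K) ℕP.≤-<-trans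

≈⇒≈-below : ∀ {p K f g} → Full._≈_ p f g → Below._≈_ p K f g
≈⇒≈-below f≈g = Below.mk≈ λ n _ → Full.at f≈g n tt

module Coefficients (p : ℕ) where
  open Congruence p

  conv-≋0 : ∀ f g n k → (∀ i → i ≤ k → f i * g (n ∸ i) ≋ + 0) → conv f g n k ≋ + 0
  conv-≋0 f g n zero    terms = terms 0 z≤n
  conv-≋0 f g n (suc k) terms =
    +-cong (conv-≋0 f g n k λ i i≤k → terms i (ℕP.m≤n⇒m≤1+n i≤k)) (terms (suc k) ℕP.≤-refl)

  ⊛-≋0-below : ∀ {f g} s t → (∀ i → i < s → f i ≋ + 0) → (∀ j → j < t → g j ≋ + 0)
    → ∀ n → n < s ℕ.+ t → (f ⊛ g) n ≋ + 0
  ⊛-≋0-below {f} {g} s t f≋0 g≋0 n n<s+t = conv-≋0 f g n n term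
    where
    term : ∀ i → i ≤ n → f i * g (n ∸ i) ≋ + 0
    term i i≤n with i ℕ.<? s
    ... | yes i<s = ≋0⇒*ʳ≋0 (g (n ∸ i)) (f≋0 i i<s)
    ... | no  i≮s = ≋0⇒*ˡ≋0 (f i) (g≋0 (n ∸ i) (begin-strict
      n ∸ i           <⟨ ℕP.∸-monoˡ-< n<s+t i≤n ⟩
      s ℕ.+ t ∸ i     ≤⟨ ℕP.∸-monoʳ-≤ (s ℕ.+ t) (ℕP.≮⇒≥ i≮s) ⟩
      s ℕ.+ t ∸ s     ≡⟨ ℕP.m+n∸m≡n s t ⟩
      t               ∎))
      where open ℕP.≤-Reasoning

  ^ₚ-coeff₀≋1 : ∀ f k → f 0 ≋ + 1 → (f ^ₚ k) 0 ≋ + 1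
  ^ₚ-coeff₀≋1 f k f₀≋1 = ≋-trans (≡⇒≋ (^ₚ-coeff₀ f k)) (≋-trans (^-cong k f₀≋1) (≡⇒≋ (ℤP.^-zeroˡ k)))

  ⊛-leading : ∀ f h n → (∀ i → i < n → f i ≋ + 0) → (f ⊛ h) n ≋ f n * h 0
  ⊛-leading f h zero    _    = ≋-refl
  ⊛-leading f h (suc n) f≋0 = ≋-trans
    (+-cong (conv-≋0 f h (suc n) n λ i i≤n → ≋0⇒*ʳ≋0 (h (suc n ∸ i)) (f≋0 i (s≤s i≤n)))
            (≡⇒≋ (cong (λ j → f (suc n) * h j) (ℕP.n∸n≡0 n))))
    (≡⇒≋ (ℤP.+-identityˡ _))

-- Binomial coefficients modulo a prime

n∣n! : ∀ {n} → 0 < n → n ∣ℕ n ℕ.!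
n∣n! {suc n} _ = ℕ∣.m∣m*n (n ℕ.!)

prime∤! : ∀ {p} → Prime p → ∀ m → m < p → ¬ p ∣ℕ m ℕ.!
prime∤! p-prime zero    _   p∣1 = ¬prime[1] (subst Prime (ℕ∣.∣1⇒≡1 p∣1) p-prime)
prime∤! p-prime (suc m) m<p p∣m! with euclidsLemma (suc m) (m ℕ.!) p-prime p∣m!
... | inj₁ p∣1+m = ℕP.<⇒≱ m<p (ℕ∣.∣⇒≤ p∣1+m)
... | inj₂ p∣m!  = prime∤! p-prime m (ℕP.<-trans (ℕP.n<1+n m) m<p) p∣m!

prime∣choose : ∀ {p} → Prime p → ∀ k → 0 < k → k < p → p ∣ℕ p C k
prime∣choose {p} p-prime k 0<k k<p
  with euclidsLemma (p C k) (k ℕ.! ℕ.* (p ∸ k) ℕ.!) p-prime p∣product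
  where
  instance
    k![p-k]!≢0 : NonZero (k ℕ.! ℕ.* (p ∸ k) ℕ.!)
    k![p-k]!≢0 = k ℕP.!* (p ∸ k) !≢0
  p∣product : p ∣ℕ (p C k) ℕ.* (k ℕ.! ℕ.* (p ∸ k) ℕ.!)
  p∣product = subst (p ∣ℕ_)
    (trans (sym (m/n*n≡m (k![n∸k]!∣n! (ℕP.<⇒≤ k<p)))) (cong (ℕ._* (k ℕ.! ℕ.* (p ∸ k) ℕ.!)) (sym (nCk≡n!/k![n-k]! (ℕP.<⇒≤ k<p)))))
    (n∣n! (ℕP.<-trans 0<k k<p))
... | inj₁ p∣pCk = p∣pCk
... | inj₂ p∣k![p-k]! with euclidsLemma (k ℕ.!) ((p ∸ k) ℕ.!) p-prime p∣k![p-k]!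
...   | inj₁ p∣k!    = ⊥-elim (prime∤! p-prime k k<p p∣k!)
...   | inj₂ p∣[p-k]! = ⊥-elim (prime∤! p-prime (p ∸ k) (ℕP.∸-monoʳ-< 0<k (ℕP.<⇒≤ k<p)) p∣[p-k]!)

-- Dilation f(π) ↦ f(π^q)

dilate : ℕ → PS → PS
dilate q f n with q ∣? n
... | yes (divides k _) = f k
... | no _              = + 0

module _ {q : ℕ} .{{_ : NonZero q}} where

  dilate-* : ∀ f k → dilate q f (k ℕ.* q) ≡ f k
  dilate-* f k with q ∣? k ℕ.* q
  ... | yes (divides k′ k*q≡k′*q) = cong f (sym (ℕP.*-cancelʳ-≡ k k′ q k*q≡k′*q))
  ... | no q∤k*q                  = ⊥-elim (q∤k*q (ℕ∣.n∣m*n k))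

  dilate-∤ : ∀ f {n} → ¬ q ∣ℕ n → dilate q f n ≡ + 0
  dilate-∤ f {n} q∤n with q ∣? n
  ... | yes q∣n = ⊥-elim (q∤n q∣n)
  ... | no _    = refl

  dilate-πpow : ∀ a → dilate q (πpow a) ≗ πpow (a ℕ.* q)
  dilate-πpow a n with q ∣? n
  ... | no q∤n = sym (πpow-off-diagonal λ a*q≡n → q∤n (subst (q ∣ℕ_) a*q≡n (ℕ∣.n∣m*n a)))
  ... | yes (divides k refl) with a ℕ.≟ k
  ...   | yes refl = sym (πpow-diagonal (a ℕ.* q))
  ...   | no a≢k   = sym (πpow-off-diagonal λ a*q≡k*q → a≢k (ℕP.*-cancelʳ-≡ a k q a*q≡k*q))

  dilate-+ : ∀ f n → dilate q f (q ℕ.+ n) ≡ dilate q (tail f) n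
  dilate-+ f n with q ∣? q ℕ.+ n | q ∣? n
  ... | yes (divides k q+n≡k*q) | yes (divides j n≡j*q) =
    cong f (ℕP.*-cancelʳ-≡ k (suc j) q (trans (sym q+n≡k*q) (cong (q ℕ.+_) n≡j*q)))
  ... | yes q∣q+n | no q∤n = ⊥-elim (q∤n (ℕ∣.∣m+n∣m⇒∣n q∣q+n ℕ∣.∣-refl))
  ... | no q∤q+n  | yes q∣n = ⊥-elim (q∤q+n (ℕ∣.∣m∣n⇒∣m+n ℕ∣.∣-refl q∣n))
  ... | no _      | no _    = refl

dilate-cong : ∀ q {f g} → f ≗ g → dilate q f ≗ dilate q g
dilate-cong q f≗g n with q ∣? n
... | yes (divides k _) = f≗g k
... | no _              = refl

dilate-⊕ : ∀ q f g → dilate q f ⊕ dilate q g ≗ dilate q (f ⊕ g)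
dilate-⊕ q f g n with q ∣? n
... | yes _ = refl
... | no _  = refl

dilate-scale : ∀ q c f → scale c (dilate q f) ≗ dilate q (scale c f)
dilate-scale q c f n with q ∣? n
... | yes _ = refl
... | no _  = ℤP.*-zeroʳ c

dilate-⊖ : ∀ q f g → dilate q f ⊖ dilate q g ≗ dilate q (f ⊖ g)
dilate-⊖ q f g n with q ∣? n
... | yes _ = refl
... | no _  = refl

module Dilation (p : ℕ) where
  open Congruence p
  open Full p

  dilate-cong-below : ∀ K {q} .{{_ : NonZero q}} {f g} → Below._≈_ p K f g
    → ∀ n → n < K ℕ.* q ⊎ ¬ q ∣ℕ n → dilate q f n ≋ dilate q g n
  dilate-cong-below K {q} f≈g n n<Kq⊎q∤n with q ∣? n
  ... | no _                 = ≋-refl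
  ... | yes (divides k refl) = Below.at f≈g k (k<K n<Kq⊎q∤n)
    where
    k<K : k ℕ.* q < K ℕ.* q ⊎ ¬ q ∣ℕ k ℕ.* q → k < K
    k<K (inj₁ k*q<K*q) = ℕP.*-cancelʳ-< q k K k*q<K*q
    k<K (inj₂ q∤k*q)   = ⊥-elim (q∤k*q (ℕ∣.n∣m*n k))

  -- Writing f = f₀ + π·g gives f^q = f₀^q + π^q·g^q; recurse on g.
  additive-power⇒dilate : ∀ q .{{_ : NonZero q}}
    → (∀ f g → (f ⊕ g) ^ₚ q ≈ (f ^ₚ q) ⊕ (g ^ₚ q)) → (∀ c → c ℤ.^ q ≋ c)
    → ∀ f → f ^ₚ q ≈ dilate q f
  additive-power⇒dilate q additive fixes f = mk≈ λ n _ → <-rec P step n f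
    where
    P : ℕ → Set
    P n = ∀ f → (f ^ₚ q) n ≋ dilate q f n

    split : ∀ f n → (f ^ₚ q) n ≋ constant (f 0 ℤ.^ q) n + shiftBy q (tail f ^ₚ q) n
    split f n = ≋-trans (at (^ₚ-cong≈ q (≗⇒≈ (constant+shift-tail f))) n tt)
      (≋-trans (at (additive (constant (f 0)) (shift (tail f))) n tt)
        (≡⇒≋ (cong₂ _+_ (constant-^ₚ (f 0) q n) (shift-^ₚ (tail f) q n))))

    step : ∀ n → (∀ {m} → m < n → P m) → P n
    step zero _ f = begin
      (f ^ₚ q) 0                              ≈⟨ split f 0 ⟩
      f 0 ℤ.^ q + shiftBy q (tail f ^ₚ q) 0   ≡⟨ cong (_+_ (f 0 ℤ.^ q)) (shiftBy-below q _ 0 (ℕ.>-nonZero⁻¹ q)) ⟩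
      f 0 ℤ.^ q + + 0                         ≡⟨ ℤP.+-identityʳ _ ⟩
      f 0 ℤ.^ q                               ≈⟨ fixes (f 0) ⟩
      f 0                                     ≡⟨ dilate-* f 0 ⟨
      dilate q f 0                            ∎
      where open ≋-Reasoning
    step (suc n) rec f with suc n ℕ.<? q
    ... | yes 1+n<q = begin
      (f ^ₚ q) (suc n)                         ≈⟨ split f (suc n) ⟩
      + 0 + shiftBy q (tail f ^ₚ q) (suc n)    ≡⟨ cong (_+_ (+ 0)) (shiftBy-below q _ (suc n) 1+n<q) ⟩
      + 0                                      ≡⟨ dilate-∤ f (λ q∣n → ℕP.<⇒≱ 1+n<q (ℕ∣.∣⇒≤ q∣n)) ⟨
      dilate q f (suc n)                       ∎
      where open ≋-Reasoning
    ... | no 1+n≮q = begin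
      (f ^ₚ q) (suc n)                         ≈⟨ split f (suc n) ⟩
      + 0 + shiftBy q (tail f ^ₚ q) (suc n)    ≡⟨ ℤP.+-identityˡ _ ⟩
      shiftBy q (tail f ^ₚ q) (suc n)          ≡⟨ cong (shiftBy q (tail f ^ₚ q)) q+r≡n ⟨
      shiftBy q (tail f ^ₚ q) (q ℕ.+ r)        ≡⟨ shiftBy-+ q _ r ⟩
      (tail f ^ₚ q) r                          ≈⟨ rec r<n (tail f) ⟩
      dilate q (tail f) r                      ≡⟨ dilate-+ f r ⟨
      dilate q f (q ℕ.+ r)                     ≡⟨ cong (dilate q f) q+r≡n ⟩
      dilate q f (suc n)                       ∎
      where
      open ≋-Reasoning
      r : ℕ
      r = suc n ∸ q
      q+r≡n : q ℕ.+ r ≡ suc n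
      q+r≡n = ℕP.m+[n∸m]≡n (ℕP.≮⇒≥ 1+n≮q)
      r<n : r < suc n
      r<n = ℕP.∸-monoʳ-< {o = 0} (ℕ.>-nonZero⁻¹ q) (ℕP.≮⇒≥ 1+n≮q)

module Frobenius {p : ℕ} (p-prime : Prime p) where
  open Congruence p
  open Full p
  open Dilation p
  private
    instance
      p≢0 : NonZero p
      p≢0 = prime⇒nonZero p-prime
    module S = CommutativeSemiring seriesSemiring
    open module Exp = SemiringExp S.semiring using () renaming (_^_ to _^ₛ_)
    open module Mult = SemiringMult S.semiring using () renaming (_×_ to _×ₛ_)
    open module Sum = SemiringSum S.semiring using (sum)

  ^ₚ≗^ₛ : ∀ f n → f ^ₚ n ≗ f ^ₛ n
  ^ₚ≗^ₛ f zero    i = refl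
  ^ₚ≗^ₛ f (suc n) i = ⊛-congˡ f (^ₚ≗^ₛ f n) i

  ×ₛ≗scale : ∀ n f → n ×ₛ f ≗ scale (+ n) f
  ×ₛ≗scale zero    f i = sym (ℤP.*-zeroˡ (f i))
  ×ₛ≗scale (suc n) f i = trans (cong (_+_ (f i)) (×ₛ≗scale n f i)) (lemma (f i) (+ n))
    where lemma : ∀ x n → x + n * x ≡ (+ 1 + n) * x
          lemma = solve-∀

  multiple×ₛ≈0 : ∀ {n} f → p ∣ℕ n → n ×ₛ f ≈ zeroₚ
  multiple×ₛ≈0 {n} f (divides k n≡k*p) = mk≈ λ i _ → begin
    (n ×ₛ f) i          ≡⟨ ×ₛ≗scale n f i ⟩
    + n * f i          ≡⟨ cong (λ m → + m * f i) n≡k*p ⟩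
    + (k ℕ.* p) * f i  ≡⟨ cong (_* f i) (ℤP.pos-* k p) ⟩
    + k * + p * f i    ≡⟨ swap (+ k) (+ p) (f i) ⟩
    + k * f i * + p    ≈⟨ multiple≋0 (+ k * f i) ⟩
    + 0                ∎
    where
    open ≋-Reasoning
    swap : ∀ a b c → a * b * c ≡ a * c * b
    swap = solve-∀

  private module Binom = Binomial seriesSemiring

  binomialTerm-first : ∀ x y n → Binom.binomialTerm x y n Fin.zero ≈ y ^ₚ n
  binomialTerm-first x y n = ≈-trans (Mult.×-homo-1 _) (≗⇒≈ λ i →
    trans (⊛-identityˡ (y ^ₛ n) i) (sym (^ₚ≗^ₛ y n i)))

  binomialTerm-last : ∀ x y n → Binom.binomialTerm x y n (fromℕ n) ≈ x ^ₚ n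
  binomialTerm-last x y n rewrite FinP.toℕ-fromℕ n | nCn≡1 n | ℕP.n∸n≡0 n =
    ≈-trans (Mult.×-homo-1 _) (≗⇒≈ λ i → trans (⊛-identityʳ (x ^ₛ n) i) (sym (^ₚ≗^ₛ x n i)))

  binomialExpansion-collapse : ∀ x y m → (∀ k → 0 < k → k < suc m → p ∣ℕ suc m C k)
    → Binom.binomialExpansion x y (suc m) ≈ (x ^ₚ suc m) ⊕ (y ^ₚ suc m)
  binomialExpansion-collapse x y m p∣C = begin
    t Fin.zero ⊕ sum (t ∘ Fin.suc)
      ≈⟨ ⊕-cong (binomialTerm-first x y (suc m)) (Sum.sum-init-last (t ∘ Fin.suc)) ⟩
    (y ^ₚ suc m) ⊕ (sum (λ i → t (Fin.suc (inject₁ i))) ⊕ t (fromℕ (suc m)))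
      ≈⟨ ⊕-cong (≈-refl {y ^ₚ suc m}) (⊕-cong inner-terms (binomialTerm-last x y (suc m))) ⟩
    (y ^ₚ suc m) ⊕ (zeroₚ ⊕ (x ^ₚ suc m))
      ≈⟨ ≗⇒≈ (λ i → trans (cong (_+_ ((y ^ₚ suc m) i)) (ℤP.+-identityˡ ((x ^ₚ suc m) i)))
                                  (ℤP.+-comm ((y ^ₚ suc m) i) ((x ^ₚ suc m) i))) ⟩
    (x ^ₚ suc m) ⊕ (y ^ₚ suc m) ∎
    where
    open ≈-Reasoning
    t : Fin (suc (suc m)) → PS
    t = Binom.binomialTerm x y (suc m)
    inner-terms : sum (λ i → t (Fin.suc (inject₁ i))) ≈ zeroₚ
    inner-terms = ≈-trans (Sum.sum-cong-≋ {m} λ i → multiple×ₛ≈0 _ (p∣C _ (s≤s z≤n)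
                            (s≤s (subst (_< m) (sym (FinP.toℕ-inject₁ i)) (FinP.toℕ<n i)))))
                          (Sum.sum-replicate-zero m)

  freshman : ∀ x y → (x ⊕ y) ^ₚ p ≈ (x ^ₚ p) ⊕ (y ^ₚ p)
  freshman x y = subst (λ n → (x ⊕ y) ^ₚ n ≈ (x ^ₚ n) ⊕ (y ^ₚ n)) (ℕP.suc-pred p) (begin
    (x ⊕ y) ^ₚ suc m                ≈⟨ ≗⇒≈ (^ₚ≗^ₛ (x ⊕ y) (suc m)) ⟩
    (x ⊕ y) ^ₛ suc m                ≈⟨ Binom.theorem (suc m) x y ⟩
    Binom.binomialExpansion x y (suc m) ≈⟨ binomialExpansion-collapse x y m p∣C ⟩
    (x ^ₚ suc m) ⊕ (y ^ₚ suc m)     ∎)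
    where
    open ≈-Reasoning
    m : ℕ
    m = ℕ.pred p
    p∣C : ∀ k → 0 < k → k < suc m → p ∣ℕ suc m C k
    p∣C k 0<k k<p = subst (λ n → p ∣ℕ n C k) (sym (ℕP.suc-pred p))
                          (prime∣choose p-prime k 0<k (subst (k <_) (ℕP.suc-pred p) k<p))

  freshman-^ : ∀ v x y → (x ⊕ y) ^ₚ (p ^ v) ≈ (x ^ₚ (p ^ v)) ⊕ (y ^ₚ (p ^ v))
  freshman-^ zero x y = ≗⇒≈ λ i →
    trans (⊛-identityʳ (x ⊕ y) i) (sym (cong₂ _+_ (⊛-identityʳ x i) (⊛-identityʳ y i)))
  freshman-^ (suc v) x y = begin
    (x ⊕ y) ^ₚ (p ℕ.* p ^ v)                  ≈⟨ ≗⇒≈ (^ₚ-* (x ⊕ y) p (p ^ v)) ⟩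
    ((x ⊕ y) ^ₚ p) ^ₚ (p ^ v)                 ≈⟨ ^ₚ-cong≈ (p ^ v) (freshman x y) ⟩
    ((x ^ₚ p) ⊕ (y ^ₚ p)) ^ₚ (p ^ v)          ≈⟨ freshman-^ v (x ^ₚ p) (y ^ₚ p) ⟩
    ((x ^ₚ p) ^ₚ (p ^ v)) ⊕ ((y ^ₚ p) ^ₚ (p ^ v))
      ≈⟨ ≈-sym (≗⇒≈ λ i → cong₂ _+_ (^ₚ-* x p (p ^ v) i) (^ₚ-* y p (p ^ v) i)) ⟩
    (x ^ₚ (p ℕ.* p ^ v)) ⊕ (y ^ₚ (p ℕ.* p ^ v)) ∎
    where open ≈-Reasoning

  freshman-ℤ : ∀ v a b → (a + b) ℤ.^ (p ^ v) ≋ a ℤ.^ (p ^ v) + b ℤ.^ (p ^ v)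
  freshman-ℤ v a b = begin
    (a + b) ℤ.^ (p ^ v)                                      ≡⟨ ^ₚ-coeff₀ (constant a ⊕ constant b) (p ^ v) ⟨
    ((constant a ⊕ constant b) ^ₚ (p ^ v)) 0                 ≈⟨ at (freshman-^ v (constant a) (constant b)) 0 tt ⟩
    (constant a ^ₚ (p ^ v)) 0 + (constant b ^ₚ (p ^ v)) 0    ≡⟨ cong₂ _+_ (^ₚ-coeff₀ (constant a) (p ^ v))
                                                                          (^ₚ-coeff₀ (constant b) (p ^ v)) ⟩
    a ℤ.^ (p ^ v) + b ℤ.^ (p ^ v)                             ∎
    where open ≋-Reasoning

  fermat : ∀ v c → c ℤ.^ (p ^ v) ≋ c
  fermat v (+ n)    = fermat-ℕ n
    where
    fermat-ℕ : ∀ n → (+ n) ℤ.^ (p ^ v) ≋ + n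
    fermat-ℕ zero    = ≡⇒≋ (zero-^ (p ^ v) {{ℕP.m^n≢0 p v}})
      where zero-^ : ∀ k .{{_ : NonZero k}} → (+ 0) ℤ.^ k ≡ + 0
            zero-^ (suc k) = ℤP.*-zeroˡ ((+ 0) ℤ.^ k)
    fermat-ℕ (suc n) = ≋-trans (freshman-ℤ v (+ 1) (+ n)) (+-cong (≡⇒≋ (ℤP.^-zeroˡ (p ^ v))) (fermat-ℕ n))
  fermat v -[1+ n ] = begin
    (- + suc n) ℤ.^ q                                  ≡⟨ lemma ((- + suc n) ℤ.^ q) ((+ suc n) ℤ.^ q) ⟩
    (+ suc n) ℤ.^ q + (- + suc n) ℤ.^ q - (+ suc n) ℤ.^ q
      ≈⟨ +-cong (≋-sym (freshman-ℤ v (+ suc n) (- + suc n))) (-‿cong (fermat v (+ suc n))) ⟩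
    (+ suc n - + suc n) ℤ.^ q - + suc n                ≡⟨ cong (λ c → c ℤ.^ q - + suc n) (ℤP.+-inverseʳ (+ suc n)) ⟩
    (+ 0) ℤ.^ q - + suc n                              ≈⟨ +-cong (fermat v (+ 0)) ≋-refl ⟩
    -[1+ n ]                                           ∎
    where
    open ≋-Reasoning
    q : ℕ
    q = p ^ v
    lemma : ∀ x y → x ≡ y + x - y
    lemma = solve-∀

  frobenius : ∀ v f → f ^ₚ (p ^ v) ≈ dilate (p ^ v) f
  frobenius v = additive-power⇒dilate (p ^ v) {{ℕP.m^n≢0 p v}} (freshman-^ v) (fermat v)

module Quotients (p : ℕ) where
  open Congruence p
  open Full p

  -- w = x^k for k = P - Q, recorded without inverses as w·x^Q = x^P.
  record Quotient (x w : PS) (k : ℤ) : Set where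
    field
      numerator denominator : ℕ
      exponent              : k ≡ + numerator - + denominator
      cleared               : w ⊛ (x ^ₚ denominator) ≈ x ^ₚ numerator

  IsPowℤ⇒Quotient : ∀ {x w} k → IsPowℤ p x k w → Quotient x w k
  IsPowℤ⇒Quotient {x} {w} (+ k) w≈x^k = record
    { numerator = k ; denominator = 0 ; exponent = sym (ℤP.+-identityʳ (+ k))
    ; cleared   = ≈-trans (≗⇒≈ (⊛-identityʳ w)) (mk≈ λ n _ → fromCongruent (w≈x^k n)) }
  IsPowℤ⇒Quotient -[1+ k ] w⊛x^k≈1 = record
    { numerator = 0 ; denominator = suc k ; exponent = sym (ℤP.+-identityˡ -[1+ k ])
    ; cleared   = mk≈ λ n _ → fromCongruent (w⊛x^k≈1 n) }

  Quotient-⊛ : ∀ {x w w′ k k′} → Quotient x w k → Quotient x w′ k′ → Quotient x (w ⊛ w′) (k + k′)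
  Quotient-⊛ {x} {w} {w′} {k} {k′} q q′ = record
    { numerator = P ℕ.+ P′ ; denominator = Q ℕ.+ Q′
    ; exponent  = trans (cong₂ _+_ (Quotient.exponent q) (Quotient.exponent q′)) (lemma P Q P′ Q′)
    ; cleared   = begin
      (w ⊛ w′) ⊛ (x ^ₚ (Q ℕ.+ Q′))               ≈⟨ ≗⇒≈ (⊛-congˡ (w ⊛ w′) (^ₚ-+ x Q Q′)) ⟩
      (w ⊛ w′) ⊛ ((x ^ₚ Q) ⊛ (x ^ₚ Q′))          ≈⟨ ≗⇒≈ (⊛-interchange w w′ (x ^ₚ Q) (x ^ₚ Q′)) ⟩
      (w ⊛ (x ^ₚ Q)) ⊛ (w′ ⊛ (x ^ₚ Q′))          ≈⟨ ⊛-cong≈ (Quotient.cleared q) (Quotient.cleared q′) ⟩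
      (x ^ₚ P) ⊛ (x ^ₚ P′)                       ≈⟨ ≗⇒≈ (^ₚ-+ x P P′) ⟨
      x ^ₚ (P ℕ.+ P′)                            ∎ }
    where
    open ≈-Reasoning
    open Quotient q  using () renaming (numerator to P; denominator to Q)
    open Quotient q′ using () renaming (numerator to P′; denominator to Q′)
    lemma : ∀ P Q P′ Q′ → + P - + Q + (+ P′ - + Q′) ≡ + (P ℕ.+ P′) - + (Q ℕ.+ Q′)
    lemma P Q P′ Q′ = trans (shuffle (+ P) (+ Q) (+ P′) (+ Q′)) (sym (cong₂ _-_ (ℤP.pos-+ P P′) (ℤP.pos-+ Q Q′)))
      where shuffle : ∀ P Q P′ Q′ → P - Q + (P′ - Q′) ≡ (P + P′) - (Q + Q′)
            shuffle = solve-∀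

  Quotient-^ₚ : ∀ {x y w k} g → y ≈ x ^ₚ g → Quotient y w k → Quotient x w (k * + g)
  Quotient-^ₚ {x} {y} {w} {k} g y≈x^g q = record
    { numerator = g ℕ.* P ; denominator = g ℕ.* Q
    ; exponent  = trans (cong (_* + g) (Quotient.exponent q)) (lemma P Q)
    ; cleared   = begin
      w ⊛ (x ^ₚ (g ℕ.* Q))       ≈⟨ ≗⇒≈ (⊛-congˡ w (^ₚ-* x g Q)) ⟩
      w ⊛ ((x ^ₚ g) ^ₚ Q)        ≈⟨ ⊛-congˡ≈ w (^ₚ-cong≈ Q y≈x^g) ⟨
      w ⊛ (y ^ₚ Q)               ≈⟨ Quotient.cleared q ⟩
      y ^ₚ P                     ≈⟨ ^ₚ-cong≈ P y≈x^g ⟩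
      (x ^ₚ g) ^ₚ P              ≈⟨ ≗⇒≈ (^ₚ-* x g P) ⟨
      x ^ₚ (g ℕ.* P)             ∎ }
    where
    open ≈-Reasoning
    open Quotient q using () renaming (numerator to P; denominator to Q)
    lemma : ∀ P Q → (+ P - + Q) * + g ≡ + (g ℕ.* P) - + (g ℕ.* Q)
    lemma P Q = trans (distrib (+ P) (+ Q) (+ g)) (sym (cong₂ _-_ (ℤP.pos-* g P) (ℤP.pos-* g Q)))
      where distrib : ∀ P Q g → (P - Q) * g ≡ g * P - g * Q
            distrib = solve-∀

module Descent (p : ℕ) {q : ℕ} .{{_ : NonZero q}} (frobenius : ∀ f → Full._≈_ p (f ^ₚ q) (dilate q f)) where
  open Congruence p
  open Full p
  open Quotients p
  open Coefficients p

  dilate-⊛ : ∀ f g → dilate q f ⊛ dilate q g ≈ dilate q (f ⊛ g)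
  dilate-⊛ f g = begin
    dilate q f ⊛ dilate q g   ≈⟨ ⊛-cong≈ (≈-sym (frobenius f)) (≈-sym (frobenius g)) ⟩
    (f ^ₚ q) ⊛ (g ^ₚ q)       ≈⟨ ≗⇒≈ (^ₚ-distrib-⊛ f g q) ⟨
    (f ⊛ g) ^ₚ q              ≈⟨ frobenius (f ⊛ g) ⟩
    dilate q (f ⊛ g)          ∎
    where open ≈-Reasoning

  -- A lowest coefficient of R off the multiples of q would survive in R ⊛ H, as H is a unit.
  ≈0-if-⊛-dilate : ∀ R H Z → H 0 ≋ + 1 → R ⊛ H ≈ dilate q Z → (∀ k → R (k ℕ.* q) ≋ + 0) → R ≈ zeroₚ
  ≈0-if-⊛-dilate R H Z H₀≋1 R⊛H≈ R[kq]≋0 = mk≈ λ n _ → <-rec (λ n → R n ≋ + 0) step n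
    where
    step : ∀ n → (∀ {m} → m < n → R m ≋ + 0) → R n ≋ + 0
    step n below with q ∣? n
    ... | yes (divides k n≡k*q) = subst (λ m → R m ≋ + 0) (sym n≡k*q) (R[kq]≋0 k)
    ... | no q∤n = begin
      R n          ≡⟨ ℤP.*-identityʳ (R n) ⟨
      R n * + 1    ≈⟨ *-cong (≋-refl {R n}) (≋-sym H₀≋1) ⟩
      R n * H 0    ≈⟨ ⊛-leading R H n (λ i i<n → below i<n) ⟨
      (R ⊛ H) n    ≈⟨ at R⊛H≈ n tt ⟩
      dilate q Z n ≡⟨ dilate-∤ Z q∤n ⟩
      + 0          ∎
      where open ≋-Reasoning

  descent : ∀ W A B → A 0 ≋ + 1 → W ⊛ dilate q A ≈ dilate q B
    → W ≈ dilate q (λ k → W (k ℕ.* q)) × ((λ k → W (k ℕ.* q)) ⊛ A ≈ B)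
  descent W A B A₀≋1 W⊛A≈B = W≈dilate[Y] , Y⊛A≈B
    where
    Y R H Z : PS
    Y k = W (k ℕ.* q)
    R = W ⊖ dilate q Y
    H = dilate q A
    Z = B ⊖ (Y ⊛ A)

    R⊛H≈dilate[Z] : R ⊛ H ≈ dilate q Z
    R⊛H≈dilate[Z] = begin
      (W ⊖ dilate q Y) ⊛ H             ≈⟨ ≗⇒≈ (⊛-distribʳ-⊖ W (dilate q Y) H) ⟩
      (W ⊛ H) ⊖ (dilate q Y ⊛ H)       ≈⟨ ⊖-cong W⊛A≈B (dilate-⊛ Y A) ⟩
      dilate q B ⊖ dilate q (Y ⊛ A)    ≈⟨ ≗⇒≈ (dilate-⊖ q B (Y ⊛ A)) ⟩
      dilate q Z                       ∎
      where open ≈-Reasoning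

    R≈0 : R ≈ zeroₚ
    R≈0 = ≈0-if-⊛-dilate R H Z (≋-trans (≡⇒≋ (dilate-* {q} A 0)) A₀≋1) R⊛H≈dilate[Z] λ k →
      ≡⇒≋ (trans (cong (_-_ (W (k ℕ.* q))) (dilate-* Y k)) (ℤP.+-inverseʳ (W (k ℕ.* q))))

    W≈dilate[Y] : W ≈ dilate q Y
    W≈dilate[Y] = mk≈ λ n _ → difference≋0⇒≋ (at R≈0 n tt)

    Y⊛A≈B : Y ⊛ A ≈ B
    Y⊛A≈B = mk≈ λ k _ → ≋-sym (difference≋0⇒≋ (begin
      Z k                      ≡⟨ dilate-* Z k ⟨
      dilate q Z (k ℕ.* q)     ≈⟨ at R⊛H≈dilate[Z] (k ℕ.* q) tt ⟨
      (R ⊛ H) (k ℕ.* q)        ≈⟨ at (⊛-congʳ≈ H R≈0) (k ℕ.* q) tt ⟩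
      (zeroₚ ⊛ H) (k ℕ.* q)    ≡⟨ ⊛-zeroˡ H (k ℕ.* q) ⟩
      + 0                      ∎))
      where open ≋-Reasoning

  private
    q′ : ℕ
    q′ = ℕ.pred q
    1+q′≡q : suc q′ ≡ q
    1+q′≡q = ℕP.suc-pred q

    exponent : ∀ m P Q → + P - + Q ≡ m * + q → (m + + Q) * + q ≡ + (P ℕ.+ q′ ℕ.* Q)
    exponent m P Q P-Q≡m*q = begin
      (m + + Q) * + q                     ≡⟨ cong (λ t → (m + + Q) * + t) 1+q′≡q ⟨
      (m + + Q) * (+ 1 + + q′)            ≡⟨ lemma₁ m (+ Q) (+ q′) ⟩
      m * (+ 1 + + q′) + + Q + + q′ * + Q ≡⟨ cong (λ t → m * + t + + Q + + q′ * + Q) 1+q′≡q ⟩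
      m * + q + + Q + + q′ * + Q          ≡⟨ cong (λ x → x + + Q + + q′ * + Q) P-Q≡m*q ⟨
      + P - + Q + + Q + + q′ * + Q        ≡⟨ lemma₂ (+ P) (+ Q) (+ q′) ⟩
      + P + + q′ * + Q                    ≡⟨ cong (_+_ (+ P)) (ℤP.pos-* q′ Q) ⟨
      + P + + (q′ ℕ.* Q)                  ≡⟨ ℤP.pos-+ P (q′ ℕ.* Q) ⟨
      + (P ℕ.+ q′ ℕ.* Q)                  ∎
      where
      open ≡-Reasoning
      lemma₁ : ∀ m Q q′ → (m + Q) * (+ 1 + q′) ≡ m * (+ 1 + q′) + Q + q′ * Q
      lemma₁ = solve-∀
      lemma₂ : ∀ P Q q′ → P - Q + Q + q′ * Q ≡ P + q′ * Q
      lemma₂ = solve-∀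

  ⊛-dilate-^ₚ : ∀ {W x} {P Q} → W ⊛ (x ^ₚ Q) ≈ x ^ₚ P → W ⊛ dilate q (x ^ₚ Q) ≈ x ^ₚ (P ℕ.+ q′ ℕ.* Q)
  ⊛-dilate-^ₚ {W} {x} {P} {Q} W⊛x^Q≈x^P = begin
    W ⊛ dilate q (x ^ₚ Q)                     ≈⟨ ⊛-congˡ≈ W (frobenius (x ^ₚ Q)) ⟨
    W ⊛ ((x ^ₚ Q) ^ₚ q)                        ≈⟨ ≗⇒≈ (⊛-congˡ W (^ₚ-* x Q q)) ⟨
    W ⊛ (x ^ₚ (Q ℕ.* q))                       ≡⟨ cong (λ k → W ⊛ (x ^ₚ k)) Q*q≡ ⟩
    W ⊛ (x ^ₚ (Q ℕ.+ q′ ℕ.* Q))                ≈⟨ ≗⇒≈ (⊛-congˡ W (^ₚ-+ x Q (q′ ℕ.* Q))) ⟩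
    W ⊛ ((x ^ₚ Q) ⊛ (x ^ₚ (q′ ℕ.* Q)))         ≈⟨ ≗⇒≈ (⊛-assoc W (x ^ₚ Q) (x ^ₚ (q′ ℕ.* Q))) ⟨
    (W ⊛ (x ^ₚ Q)) ⊛ (x ^ₚ (q′ ℕ.* Q))         ≈⟨ ⊛-congʳ≈ (x ^ₚ (q′ ℕ.* Q)) W⊛x^Q≈x^P ⟩
    (x ^ₚ P) ⊛ (x ^ₚ (q′ ℕ.* Q))               ≈⟨ ≗⇒≈ (^ₚ-+ x P (q′ ℕ.* Q)) ⟨
    x ^ₚ (P ℕ.+ q′ ℕ.* Q)                      ∎
    where
    open ≈-Reasoning
    Q*q≡ : Q ℕ.* q ≡ Q ℕ.+ q′ ℕ.* Q
    Q*q≡ = trans (cong (Q ℕ.*_) (sym 1+q′≡q)) (lemma Q q′)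
      where lemma : ∀ Q q′ → Q ℕ.* suc q′ ≡ Q ℕ.+ q′ ℕ.* Q
            lemma = ℕ-solve-∀

  -- The exponent m + Q is a natural number because (m + Q)q = P + (q - 1)Q.
  descent-of-Quotient : ∀ {x W m} → x 0 ≋ + 1 → Quotient x W (m * + q)
    → W ≈ dilate q (λ k → W (k ℕ.* q)) × Quotient x (λ k → W (k ℕ.* q)) m
  descent-of-Quotient {x} {W} {m} x₀≋1
    record { numerator = P ; denominator = Q ; exponent = m*q≡P-Q ; cleared = W⊛x^Q≈x^P } with m + + Q in m+Q≡
  ... | + m′ = proj₁ descended , record
    { numerator = m′ ; denominator = Q ; exponent = m≡m′-Q ; cleared = proj₂ descended }
    where
    m′*q≡ : m′ ℕ.* q ≡ P ℕ.+ q′ ℕ.* Q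
    m′*q≡ = ℤP.+-injective (trans (ℤP.pos-* m′ q) (trans (cong (_* + q) (sym m+Q≡)) (exponent m P Q (sym m*q≡P-Q))))
    m≡m′-Q : m ≡ + m′ - + Q
    m≡m′-Q = trans (sym (lemma m (+ Q))) (cong (_- + Q) m+Q≡)
      where lemma : ∀ m Q → m + Q - Q ≡ m
            lemma = solve-∀
    W⊛dilate≈dilate : W ⊛ dilate q (x ^ₚ Q) ≈ dilate q (x ^ₚ m′)
    W⊛dilate≈dilate = begin
      W ⊛ dilate q (x ^ₚ Q)      ≈⟨ ⊛-dilate-^ₚ {P = P} {Q} W⊛x^Q≈x^P ⟩
      x ^ₚ (P ℕ.+ q′ ℕ.* Q)      ≡⟨ cong (x ^ₚ_) m′*q≡ ⟨
      x ^ₚ (m′ ℕ.* q)            ≈⟨ ≗⇒≈ (^ₚ-* x m′ q) ⟩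
      (x ^ₚ m′) ^ₚ q             ≈⟨ frobenius (x ^ₚ m′) ⟩
      dilate q (x ^ₚ m′)         ∎
      where open ≈-Reasoning
    descended : W ≈ dilate q (λ k → W (k ℕ.* q)) × (λ k → W (k ℕ.* q)) ⊛ (x ^ₚ Q) ≈ x ^ₚ m′
    descended = descent W (x ^ₚ Q) (x ^ₚ m′) (^ₚ-coeff₀≋1 x Q x₀≋1) W⊛dilate≈dilate
  ... | -[1+ k ] = ⊥-elim (negative (trans (cong (λ t → -[1+ k ] * + t) 1+q′≡q)
                                      (trans (cong (_* + q) (sym m+Q≡)) (exponent m P Q (sym m*q≡P-Q)))))
    where negative : ∀ {n} → -[1+ k ] * + suc q′ ≢ + n
          negative ()

module Roots (p : ℕ) where
  open Congruence p
  open Coefficients p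

  ^ₚ-difference-at : ∀ x y n → x 0 ≋ + 1 → y 0 ≋ + 1 → (∀ i → i < n → x i ≋ y i)
    → ∀ k → ((x ^ₚ k) ⊖ (y ^ₚ k)) n ≋ + k * (x n - y n)
  ^ₚ-difference-at x y n x₀≋1 y₀≋1 x≋y zero = ≡⇒≋ (trans (ℤP.+-inverseʳ (one n)) (sym (ℤP.*-zeroˡ (x n - y n))))
  ^ₚ-difference-at x y n x₀≋1 y₀≋1 x≋y (suc k) = begin
    ((x ⊛ (x ^ₚ k)) ⊖ (y ⊛ (y ^ₚ k))) n
      ≡⟨ ⊛-difference x (x ^ₚ k) y (y ^ₚ k) n ⟩
    (x ⊛ e) n + ((x ⊖ y) ⊛ (y ^ₚ k)) n
      ≡⟨ cong (_+ ((x ⊖ y) ⊛ (y ^ₚ k)) n) (⊛-comm x e n) ⟩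
    (e ⊛ x) n + ((x ⊖ y) ⊛ (y ^ₚ k)) n
      ≈⟨ +-cong (⊛-leading e x n e≋0) (⊛-leading (x ⊖ y) (y ^ₚ k) n d≋0) ⟩
    e n * x 0 + (x n - y n) * (y ^ₚ k) 0
      ≈⟨ +-cong (*-cong (^ₚ-difference-at x y n x₀≋1 y₀≋1 x≋y k) x₀≋1) (*-cong (≋-refl {x n - y n}) (^ₚ-coeff₀≋1 y k y₀≋1)) ⟩
    + k * (x n - y n) * + 1 + (x n - y n) * + 1
      ≡⟨ lemma (+ k) (x n - y n) ⟩
    + suc k * (x n - y n) ∎
    where
    open ≋-Reasoning
    module Tr = Below p n
    e : PS
    e = (x ^ₚ k) ⊖ (y ^ₚ k)
    d≋0 : ∀ i → i < n → (x ⊖ y) i ≋ + 0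
    d≋0 i i<n = ≋-trans (+-cong (x≋y i i<n) (≋-refl { - y i})) (≡⇒≋ (ℤP.+-inverseʳ (y i)))
    e≋0 : ∀ i → i < n → e i ≋ + 0
    e≋0 i i<n = ≋-trans (+-cong (Tr.at (Tr.^ₚ-cong≈ k (Tr.mk≈ x≋y)) i i<n) (≋-refl { - (y ^ₚ k) i}))
                        (≡⇒≋ (ℤP.+-inverseʳ ((y ^ₚ k) i)))
    lemma : ∀ k d → k * d * + 1 + d * + 1 ≡ (+ 1 + k) * d
    lemma = solve-∀

  root-unique : ∀ g → + g ≋ + 1 → ∀ K x y → x 0 ≋ + 1 → y 0 ≋ + 1
    → (∀ n → n < K → (x ^ₚ g) n ≋ (y ^ₚ g) n) → ∀ n → n < K → x n ≋ y n
  root-unique g g≋1 K x y x₀≋1 y₀≋1 x^g≋y^g = <-rec (λ n → n < K → x n ≋ y n) step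
    where
    step : ∀ n → (∀ {m} → m < n → m < K → x m ≋ y m) → n < K → x n ≋ y n
    step n below n<K = difference≋0⇒≋ (begin
      x n - y n                              ≡⟨ ℤP.*-identityˡ (x n - y n) ⟨
      + 1 * (x n - y n)                      ≈⟨ *-cong (≋-sym g≋1) (≋-refl {x n - y n}) ⟩
      + g * (x n - y n)                      ≈⟨ ^ₚ-difference-at x y n x₀≋1 y₀≋1 x≋y g ⟨
      (x ^ₚ g) n - (y ^ₚ g) n                ≈⟨ +-cong (x^g≋y^g n n<K) (≋-refl { - (y ^ₚ g) n}) ⟩
      (y ^ₚ g) n - (y ^ₚ g) n                ≡⟨ ℤP.+-inverseʳ ((y ^ₚ g) n) ⟩
      + 0                                    ∎)
      where
      open ≋-Reasoning
      x≋y : ∀ i → i < n → x i ≋ y i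
      x≋y i i<n = below i<n (ℕP.<-trans i<n n<K)

-- Series 1 + cM modulo π^(2a), where M vanishes below degree a

module FirstOrder (p : ℕ) (M : PS) (a : ℕ) (M-below : ∀ i → i < a → M i ≡ + 0) where
  open Congruence p
  open Coefficients p
  open Below p (a ℕ.+ a)

  E : ℤ → PS
  E c = one ⊕ scale c M

  E-⊛-exact : ∀ c d n → (E c ⊛ E d) n ≡ one n + (c + d) * M n + c * d * (M ⊛ M) n
  E-⊛-exact c d n = begin
    (E c ⊛ E d) n                                  ≡⟨ ⊛-distribʳ-⊕ one (scale c M) (E d) n ⟩
    (one ⊛ E d) n + (scale c M ⊛ E d) n            ≡⟨ cong₂ _+_ (⊛-identityˡ (E d) n) (scale-⊛ c M (E d) n) ⟩
    E d n + c * (M ⊛ E d) n                        ≡⟨ cong (λ w → E d n + c * w) (⊛-distribˡ-⊕ M one (scale d M) n) ⟩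
    E d n + c * ((M ⊛ one) n + (M ⊛ scale d M) n)  ≡⟨ cong (λ w → E d n + c * w)
                                                         (cong₂ _+_ (⊛-identityʳ M n) (⊛-scale d M M n)) ⟩
    one n + d * M n + c * (M n + d * (M ⊛ M) n)    ≡⟨ lemma (one n) c d (M n) ((M ⊛ M) n) ⟩
    one n + (c + d) * M n + c * d * (M ⊛ M) n      ∎
    where
    open ≡-Reasoning
    lemma : ∀ o c d m w → o + d * m + c * (m + d * w) ≡ o + (c + d) * m + c * d * w
    lemma = solve-∀

  E-⊛ : ∀ c d → E c ⊛ E d ≈ E (c + d)
  E-⊛ c d = mk≈ λ n n<2a → begin
    (E c ⊛ E d) n                               ≡⟨ E-⊛-exact c d n ⟩
    E (c + d) n + c * d * (M ⊛ M) n             ≈⟨ +-cong (≋-refl {E (c + d) n})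
                                                     (≋0⇒*ˡ≋0 (c * d) (⊛-≋0-below a a M≋0 M≋0 n n<2a)) ⟩
    E (c + d) n + + 0                           ≡⟨ ℤP.+-identityʳ (E (c + d) n) ⟩
    E (c + d) n                                 ∎
    where
    open ≋-Reasoning
    M≋0 : ∀ i → i < a → M i ≋ + 0
    M≋0 i i<a = ≡⇒≋ (M-below i i<a)

  E-cong : ∀ {c d} → c ≋ d → E c ≈ E d
  E-cong c≋d = ⊕-cong (≈-refl {one}) (scale-cong c≋d ≈-refl)

  E-zero : E (+ 0) ≗ one
  E-zero n = trans (cong (_+_ (one n)) (ℤP.*-zeroˡ (M n))) (ℤP.+-identityʳ (one n))

  E-^ₚ : ∀ {x c} → x ≈ E c → ∀ k → x ^ₚ k ≈ E (+ k * c)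
  E-^ₚ {x} {c} x≈E zero    = ≈-trans (≗⇒≈ (λ n → sym (E-zero n))) (E-cong (≡⇒≋ (sym (ℤP.*-zeroˡ c))))
  E-^ₚ {x} {c} x≈E (suc k) = ≈-trans (⊛-cong≈ x≈E (E-^ₚ x≈E k)) (≈-trans (E-⊛ c (+ k * c)) (E-cong (≡⇒≋ (lemma c (+ k)))))
    where lemma : ∀ c k → c + k * c ≡ (+ 1 + k) * c
          lemma = solve-∀

  ⊛E⇒≈E : ∀ {y c d} → y ⊛ E c ≈ E d → y ≈ E (d - c)
  ⊛E⇒≈E {y} {c} {d} y⊛E≈E = begin
    y                           ≈⟨ ≗⇒≈ (λ n → sym (⊛-identityʳ y n)) ⟩
    y ⊛ one                     ≈⟨ ⊛-congˡ≈ y (≗⇒≈ (λ n → sym (E-zero n))) ⟩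
    y ⊛ E (+ 0)                 ≈⟨ ⊛-congˡ≈ y (E-cong (≡⇒≋ (sym (ℤP.+-inverseʳ c)))) ⟩
    y ⊛ E (c - c)               ≈⟨ ⊛-congˡ≈ y (E-⊛ c (- c)) ⟨
    y ⊛ (E c ⊛ E (- c))         ≈⟨ ≗⇒≈ (⊛-assoc y (E c) (E (- c))) ⟨
    (y ⊛ E c) ⊛ E (- c)         ≈⟨ ⊛-congʳ≈ (E (- c)) y⊛E≈E ⟩
    E d ⊛ E (- c)               ≈⟨ E-⊛ d (- c) ⟩
    E (d - c)                   ∎
    where open ≈-Reasoning

  E-coeff₀ : ∀ c → 0 < a → E c 0 ≡ + 1
  E-coeff₀ c 0<a = trans (cong (λ m → + 1 + c * m) (M-below 0 0<a)) (cong (_+_ (+ 1)) (ℤP.*-zeroʳ c))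

-- (1 + π)^χ for χ ≡ 1 + zp (mod p²)

onePlusπ : PS
onePlusπ = one ⊕ shift one

onePlusπ-⊛ : ∀ f → onePlusπ ⊛ f ≗ f ⊕ shift f
onePlusπ-⊛ f n = trans (⊛-distribʳ-⊕ one (shift one) f n)
  (cong₂ _+_ (⊛-identityˡ f n) (trans (shift-⊛ one f n) (shift-cong (⊛-identityˡ f) n)))

onePlusπ-^ₚ : ∀ N k → (onePlusπ ^ₚ N) k ≡ + (N C k)
onePlusπ-^ₚ zero    zero    = refl
onePlusπ-^ₚ zero    (suc k) = cong +_ (sym (k>n⇒nCk≡0 {0} {suc k} (s≤s z≤n)))
onePlusπ-^ₚ (suc N) k = trans (⊛-congˡ onePlusπ (onePlusπ-^ₚ N) k) (trans (onePlusπ-⊛ _ k) (pascal k))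
  where
  pascal : ∀ k → + (N C k) + shift (λ j → + (N C j)) k ≡ + (suc N C k)
  pascal zero    = refl
  pascal (suc k) = trans (sym (ℤP.pos-+ (N C suc k) (N C k)))
    (cong +_ (trans (ℕP.+-comm (N C suc k) (N C k)) (nCk+nC[k+1]≡[n+1]C[k+1] N k)))

γπ/π-binomial : ∀ {p} (a : ℤₚ p) n → γπ/π a n ≡ + (truncℤₚ a (suc (suc n)) C suc n)
γπ/π-binomial a n = ℤP.+-identityʳ _

truncℤₚ-form : ∀ {p} (a : ℤₚ p) k → ∃ λ R → truncℤₚ a (suc (suc k)) ≡ digit a 0 ℕ.+ p ℕ.* (digit a 1 ℕ.+ p ℕ.* R)
truncℤₚ-form {p} a zero    = 0 , lemma (digit a 0) (digit a 1) p
  where lemma : ∀ a₀ a₁ p → 0 ℕ.+ a₀ ℕ.* 1 ℕ.+ a₁ ℕ.* (p ℕ.* 1) ≡ a₀ ℕ.+ p ℕ.* (a₁ ℕ.+ p ℕ.* 0)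
        lemma = ℕ-solve-∀
truncℤₚ-form {p} a (suc k) with truncℤₚ-form a k
... | R , eq = R ℕ.+ aₖ ℕ.* p ^ k , trans (cong (ℕ._+ aₖ ℕ.* (p ℕ.* (p ℕ.* p ^ k))) eq)
                                          (lemma (digit a 0) (digit a 1) p R aₖ (p ^ k))
  where
  aₖ : ℕ
  aₖ = digit a (suc (suc k))
  lemma : ∀ a₀ a₁ p R d t → a₀ ℕ.+ p ℕ.* (a₁ ℕ.+ p ℕ.* R) ℕ.+ d ℕ.* (p ℕ.* (p ℕ.* t))
                          ≡ a₀ ℕ.+ p ℕ.* (a₁ ℕ.+ p ℕ.* (R ℕ.+ d ℕ.* t))
  lemma = ℕ-solve-∀

module CyclotomicSeries (p-1 : ℕ) (p-prime : Prime (suc p-1)) where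
  private
    p : ℕ
    p = suc p-1
  open Congruence p
  open Full p
  open Frobenius p-prime using (freshman)
  open Dilation p using (dilate-cong-below)
  open Quotients p
  open Roots p using (root-unique)

  M : PS
  M = πpow p-1 ⊕ πpow p

  M-below : ∀ i → i < p-1 → M i ≡ + 0
  M-below i i<p-1 = cong₂ _+_ (πpow-below p-1 i i<p-1) (πpow-below p i (ℕP.m<n⇒m<1+n i<p-1))

  open FirstOrder p M p-1 M-below public

  module Trunc = Below p (p-1 ℕ.+ p-1)

  private
    module Tr = Below p (p ℕ.+ p)
    module Linear = FirstOrder p (πpow p) p (πpow-below p)

  onePlusπ-^ₚ-p : onePlusπ ^ₚ p ≈ one ⊕ πpow p
  onePlusπ-^ₚ-p = ≈-trans (freshman one (shift one)) (≗⇒≈ λ n → cong₂ _+_ (one-^ₚ p n)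
    (trans (shift-^ₚ one p n) (trans (shiftBy-cong p (one-^ₚ p) n) (shiftBy-one p n))))

  onePlusπ-^ₚ-1+pJ : ∀ J → onePlusπ ^ₚ suc (p ℕ.* J) Tr.≈ onePlusπ ⊛ Linear.E (+ J)
  onePlusπ-^ₚ-1+pJ J = Tr.⊛-congˡ≈ onePlusπ (begin
    onePlusπ ^ₚ (p ℕ.* J)          ≈⟨ ≈⇒≈-below (≈-trans (≗⇒≈ (^ₚ-* onePlusπ p J)) (^ₚ-cong≈ J onePlusπ-^ₚ-p)) ⟩
    (one ⊕ πpow p) ^ₚ J            ≈⟨ Linear.E-^ₚ (Tr.≗⇒≈ λ n → cong (_+_ (one n)) (sym (ℤP.*-identityˡ (πpow p n)))) J ⟩
    Linear.E (+ J * + 1)           ≈⟨ Tr.≗⇒≈ (λ n → cong (λ c → Linear.E c n) (ℤP.*-identityʳ (+ J))) ⟩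
    Linear.E (+ J)                 ∎)
    where open Tr.≈-Reasoning

  onePlusπ-⊛-Linear : ∀ c n → (onePlusπ ⊛ Linear.E c) (suc n) ≡ E c n
  onePlusπ-⊛-Linear c n = begin
    (onePlusπ ⊛ Linear.E c) (suc n)                           ≡⟨ onePlusπ-⊛ (Linear.E c) (suc n) ⟩
    + 0 + c * πpow p (suc n) + (one n + c * πpow p n)         ≡⟨ cong (λ w → + 0 + c * w + (one n + c * πpow p n)) (πpow-suc p-1 n) ⟩
    + 0 + c * πpow p-1 n + (one n + c * πpow p n)             ≡⟨ lemma (one n) c (πpow p-1 n) (πpow p n) ⟩
    one n + c * (πpow p-1 n + πpow p n)                       ∎
    where
    open ≡-Reasoning
    lemma : ∀ o c x y → + 0 + c * x + (o + c * y) ≡ o + c * (x + y)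
    lemma = solve-∀

  γπ/π≈E : ∀ (a : ℤₚ p) z → digit a 0 ≡ 1 → digit a 1 ≡ z → ∀ n → n < p-1 ℕ.+ p-1 → γπ/π a n ≋ E (+ z) n
  γπ/π≈E a z a₀≡1 a₁≡z n n<2[p-1] with truncℤₚ-form a n
  ... | R , trunc≡ = begin
    γπ/π a n                                        ≡⟨ γπ/π-binomial a n ⟩
    + (truncℤₚ a (suc (suc n)) C suc n)             ≡⟨ cong (λ t → + (t C suc n)) trunc≡′ ⟩
    + (suc (p ℕ.* J) C suc n)                       ≡⟨ onePlusπ-^ₚ (suc (p ℕ.* J)) (suc n) ⟨
    (onePlusπ ^ₚ suc (p ℕ.* J)) (suc n)             ≈⟨ Tr.at (onePlusπ-^ₚ-1+pJ J) (suc n) (s≤s n<2p-1) ⟩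
    (onePlusπ ⊛ Linear.E (+ J)) (suc n)             ≡⟨ onePlusπ-⊛-Linear (+ J) n ⟩
    E (+ J) n                                       ≈⟨ Below.at (E-cong J≋z) n n<2[p-1] ⟩
    E (+ z) n                                       ∎
    where
    open ≋-Reasoning
    J : ℕ
    J = z ℕ.+ p ℕ.* R
    trunc≡′ : truncℤₚ a (suc (suc n)) ≡ suc (p ℕ.* J)
    trunc≡′ = trans trunc≡ (cong₂ (λ a₀ a₁ → a₀ ℕ.+ p ℕ.* (a₁ ℕ.+ p ℕ.* R)) a₀≡1 a₁≡z)
    n<2p-1 : n < p-1 ℕ.+ p
    n<2p-1 = ℕP.<-≤-trans n<2[p-1] (ℕP.+-monoʳ-≤ p-1 (ℕP.n≤1+n p-1))
    J≋z : + J ≋ + z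
    J≋z = begin
      + (z ℕ.+ p ℕ.* R)       ≡⟨ ℤP.pos-+ z (p ℕ.* R) ⟩
      + z + + (p ℕ.* R)       ≡⟨ cong (_+_ (+ z)) (trans (ℤP.pos-* p R) (ℤP.*-comm (+ p) (+ R))) ⟩
      + z + + R * + p         ≈⟨ +-cong (≋-refl {+ z}) (multiple≋0 (+ R)) ⟩
      + z + + 0               ≡⟨ ℤP.+-identityʳ (+ z) ⟩
      + z                     ∎

  dilate-E : ∀ q .{{_ : NonZero q}} c → dilate q (E c) ≗ one ⊕ scale c (πpow (p-1 ℕ.* q) ⊕ πpow (p ℕ.* q))
  dilate-E q c n = begin
    dilate q (one ⊕ scale c M) n             ≡⟨ dilate-⊕ q one (scale c M) n ⟨
    dilate q one n + dilate q (scale c M) n  ≡⟨ cong₂ _+_ dilate-one (sym (dilate-scale q c M n)) ⟩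
    one n + c * dilate q M n                 ≡⟨ cong (λ w → one n + c * w) (sym (dilate-⊕ q (πpow p-1) (πpow p) n)) ⟩
    one n + c * (dilate q (πpow p-1) n + dilate q (πpow p) n)
      ≡⟨ cong (λ w → one n + c * w) (cong₂ _+_ (dilate-πpow p-1 n) (dilate-πpow p n)) ⟩
    one n + c * (πpow (p-1 ℕ.* q) n + πpow (p ℕ.* q) n) ∎
    where
    open ≡-Reasoning
    dilate-one : dilate q one n ≡ one n
    dilate-one = trans (dilate-cong q (shiftBy-one 0) n) (trans (dilate-πpow 0 n) (sym (shiftBy-one 0 n)))

  InTarget-dilate : ∀ q .{{_ : NonZero q}} {W Y c c′} → W ≈ dilate q Y → Y Trunc.≈ E c → c ≋ c′
    → InTarget p (W ⊖ one) c′ (p-1 ℕ.* q) (p ℕ.* q) (2 ℕ.* q ℕ.* p-1) q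
  InTarget-dilate q {W} {Y} {c} {c′} W≈dilate[Y] Y≈E c≋c′ n n∈support = toCongruent (begin
    W n - one n                          ≈⟨ +-cong (at W≈dilate[Y] n tt) (≋-refl { - one n}) ⟩
    dilate q Y n - one n                 ≈⟨ +-cong (dilate-cong-below (p-1 ℕ.+ p-1) Y≈E n n<Kq⊎q∤n) (≋-refl { - one n}) ⟩
    dilate q (E c) n - one n             ≡⟨ cong (_- one n) (dilate-E q c n) ⟩
    one n + c * Mq n - one n             ≡⟨ lemma (one n) c (Mq n) ⟩
    c * Mq n                             ≈⟨ *-cong c≋c′ (≋-refl {Mq n}) ⟩
    c′ * Mq n                            ∎)
    where
    open ≋-Reasoning
    Mq : PS
    Mq = πpow (p-1 ℕ.* q) ⊕ πpow (p ℕ.* q)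
    lemma : ∀ o c m → o + c * m - o ≡ c * m
    lemma = solve-∀
    C≡Kq : 2 ℕ.* q ℕ.* p-1 ≡ (p-1 ℕ.+ p-1) ℕ.* q
    C≡Kq = ℕ-solve-∀′ q p-1
      where ℕ-solve-∀′ : ∀ q m → 2 ℕ.* q ℕ.* m ≡ (m ℕ.+ m) ℕ.* q
            ℕ-solve-∀′ = ℕ-solve-∀
    n<Kq⊎q∤n : n < (p-1 ℕ.+ p-1) ℕ.* q ⊎ ¬ q ∣ℕ n
    n<Kq⊎q∤n = reduce n∈support
      where
      reduce : n < 2 ℕ.* q ℕ.* p-1 ⊎ (2 ℕ.* q ℕ.* p-1 ≤ n × ¬ q ∣ℕ (n ∸ 2 ℕ.* q ℕ.* p-1))
        → n < (p-1 ℕ.+ p-1) ℕ.* q ⊎ ¬ q ∣ℕ n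
      reduce (inj₁ n<C)            = inj₁ (subst (n <_) C≡Kq n<C)
      reduce (inj₂ (C≤n , q∤n∸C)) = inj₂ λ q∣n → q∤n∸C (ℕ∣.∣m+n∣m⇒∣n
        (subst (q ∣ℕ_) (sym (ℕP.m+[n∸m]≡n C≤n)) q∣n) (subst (q ∣ℕ_) (sym C≡Kq) (ℕ∣.n∣m*n (p-1 ℕ.+ p-1))))

  0<p-1 : 0 < p-1
  0<p-1 = ℕP.n≢0⇒n>0 λ p-1≡0 → ¬prime[1] (subst (λ n → Prime (suc n)) p-1≡0 p-prime)

  root-of-γπ/π : ∀ {x} (a : ℤₚ p) z g → + g ≋ + 1 → x 0 ≋ + 1 → digit a 0 ≡ 1 → digit a 1 ≡ z
    → x ^ₚ g ≈ γπ/π a → x Trunc.≈ E (+ z)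
  root-of-γπ/π {x} a z g g≋1 x₀≋1 a₀≡1 a₁≡z x^g≈γπ/π =
    Trunc.mk≈ (root-unique g g≋1 (p-1 ℕ.+ p-1) x (E (+ z)) x₀≋1 (≡⇒≋ (E-coeff₀ (+ z) 0<p-1)) x^g≋E^g)
    where
    E^g≈E : E (+ z) ^ₚ g Trunc.≈ E (+ z)
    E^g≈E = Trunc.≈-trans (E-^ₚ Trunc.≈-refl g) (E-cong (≋-trans (*-cong g≋1 (≋-refl {+ z})) (≡⇒≋ (ℤP.*-identityˡ (+ z)))))
    x^g≋E^g : ∀ n → n < p-1 ℕ.+ p-1 → (x ^ₚ g) n ≋ (E (+ z) ^ₚ g) n
    x^g≋E^g n n<K = ≋-trans (at x^g≈γπ/π n tt)
      (≋-trans (γπ/π≈E a z a₀≡1 a₁≡z n n<K) (≋-sym (Trunc.at E^g≈E n n<K)))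

  Quotient-E : ∀ {x c Y m} → x Trunc.≈ E c → Quotient x Y m → Y Trunc.≈ E (m * c)
  Quotient-E {x} {c} {Y} {m} x≈E
    record { numerator = P ; denominator = Q ; exponent = m≡P-Q ; cleared = Y⊛x^Q≈x^P } =
    Trunc.≈-trans (⊛E⇒≈E {c = + Q * c} {d = + P * c} Y⊛E≈E) (E-cong (≡⇒≋ P*c-Q*c≡m*c))
    where
    Y⊛E≈E : Y ⊛ E (+ Q * c) Trunc.≈ E (+ P * c)
    Y⊛E≈E = begin
      Y ⊛ E (+ Q * c)     ≈⟨ Trunc.⊛-congˡ≈ Y (E-^ₚ x≈E Q) ⟨
      Y ⊛ (x ^ₚ Q)        ≈⟨ ≈⇒≈-below Y⊛x^Q≈x^P ⟩
      x ^ₚ P              ≈⟨ E-^ₚ x≈E P ⟩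
      E (+ P * c)         ∎
      where open Trunc.≈-Reasoning
    P*c-Q*c≡m*c : + P * c - + Q * c ≡ m * c
    P*c-Q*c≡m*c = trans (sym (lemma (+ P) (+ Q) c)) (cong (_* c) (sym m≡P-Q))
      where lemma : ∀ P Q c → (P - Q) * c ≡ P * c - Q * c
            lemma = solve-∀

lemma4p4 : (p f : ℕ) → Prime p → 2 < p → 1 ≤ f
    → (a : ℤₚ p) (z : ℕ) → 0 < z → z ≤ p ∸ 1
    → digit a 0 ≡ 1 → digit a 1 ≡ z
    → (Σ s : ℤ) (v : ℕ)
    → (+ (p ^ v)) ∣ (Σ + s * + geomSum p f)
    → ¬ ((+ (p ^ suc v)) ∣ (Σ + s * + geomSum p f))
    → (sv : ℕ) → sv < p
    → (+ (p ^ suc v)) ∣ ((Σ + s * + geomSum p f) - + (sv ℕ.* p ^ v))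
    → (λξ : PS) → λξ 0 ≡[ p ] + 1
    → scale (+ digit a 0) (λξ ^ₚ geomSum p f) ≈[ p ] γπ/π a
    → (L U : PS) → IsPowℤ p λξ Σ L → IsPowℤ p (γπ/π a) s U
    → InTarget p ((L ⊛ U) ⊖ one) (+ (sv ℕ.* z))
        ((p ∸ 1) ℕ.* p ^ v) (p ^ suc v)
        (2 ℕ.* p ^ v ℕ.* (p ∸ 1)) (p ^ v)
lemma4p4 (suc p-1) f p-prime _ 1≤f a z _ _ a₀≡1 a₁≡z Σ s v p^v∣ᵤN _ sv _ p^[v+1]∣ᵤN-sv·p^v
         λξ λξ₀≡1 a₀·λξ^g≈γπ/π L U L-power U-power =
  InTarget-dilate (p ^ v) LU≈dilate[Y] (Quotient-E λξ≈E Y-quotient)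
    (≋-trans (*-cong m≋sv (≋-refl {+ z})) (≡⇒≋ (sym (ℤP.pos-* sv z))))
  where
  p : ℕ
  p = suc p-1
  open Congruence p
  open Full p
  open Quotients p
  open CyclotomicSeries p-1 p-prime
  instance
    p^v≢0 : NonZero (p ^ v)
    p^v≢0 = ℕP.m^n≢0 p v
  open Descent p (Frobenius.frobenius p-prime v) using (descent-of-Quotient)

  g : ℕ
  g = geomSum p f
  λξ₀≋1 : λξ 0 ≋ + 1
  λξ₀≋1 = fromCongruent λξ₀≡1
  λξ^g≈γπ/π : λξ ^ₚ g ≈ γπ/π a
  λξ^g≈γπ/π = mk≈ λ n _ → ≋-trans (≡⇒≋ (sym (trans (cong (λ d → + d * (λξ ^ₚ g) n) a₀≡1) (ℤP.*-identityˡ _))))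
                                   (fromCongruent (a₀·λξ^g≈γπ/π n))
  λξ≈E : λξ Trunc.≈ E (+ z)
  λξ≈E = root-of-γπ/π a z g (geomSum≋1 f 1≤f) λξ₀≋1 a₀≡1 a₁≡z λξ^g≈γπ/π

  p^v∣N : + (p ^ v) ℤ∣.∣ Σ + s * + g
  p^v∣N = ℤ∣.∣ᵤ⇒∣ p^v∣ᵤN
  m : ℤ
  m = ℤ∣._∣_.quotient p^v∣N
  m≋sv : m ≋ + sv
  m≋sv = quotient≋ sv p^v∣N (ℤ∣.∣ᵤ⇒∣ p^[v+1]∣ᵤN-sv·p^v)

  LU-quotient : Quotient λξ (L ⊛ U) (m * + (p ^ v))
  LU-quotient = subst (Quotient λξ (L ⊛ U)) (ℤ∣._∣_.equality p^v∣N)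
    (Quotient-⊛ (IsPowℤ⇒Quotient Σ L-power) (Quotient-^ₚ g (≈-sym λξ^g≈γπ/π) (IsPowℤ⇒Quotient s U-power)))
  Y : PS
  Y k = (L ⊛ U) (k ℕ.* p ^ v)
  LU≈dilate[Y] : L ⊛ U ≈ dilate (p ^ v) Y
  LU≈dilate[Y] = proj₁ (descent-of-Quotient {m = m} λξ₀≋1 LU-quotient)
  Y-quotient : Quotient λξ Y m
  Y-quotient = proj₂ (descent-of-Quotient {m = m} λξ₀≋1 LU-quotient)
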